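{- Assume the setting below. For $0\le j\le d$ let $Q_j$ be the matrix obtained from $Q$ by replacing its $j$-th column (columns indexed $0,\dots,d$) by $[1,0,0,\dots,0]^T$. Then $X$ is invertible if and only if $\det(Q)\neq 0$. Furthermore, if $\det(Q)\neq0$, then, setting $$y_i=\sum_{j=i}^d(-1)^{j-i}\binom{j}{i}k^{j-i}\frac{\det(Q_j)}{\det(Q)}\quad(0\le i\le d),$$ the inverse of $X$ is $$X^{ -1}=\sum_{i=0}^d y_iA^i=\sum_{i=0}^d\left(\sum_{j=i}^d(-1)^{j-i}\binom{j}{i}k^{j-i}\frac{\det(Q_j)}{\det(Q)}\right)A^i.$$
   Context: Setting: Let $d\ge 2$ and $k\ge 3$ be integers. Let numbers $c_i,a_i,b_i$ ($-1\le i\le d+1$) satisfy $c_{ -1}=c_0=0$, $c_1=1$, $c_{d+1}=0$, $b_{ -1}=0$, $b_0=k$, $b_d=b_{d+1}=0$, $a_0=0$, $k=c_i+a_i+b_i$ for all $-1\le i\le d+1$, $1=c_1\le c_2\le\cdots\le c_d\le k$ and $k=b_0\ge b_1\ge\cdots\ge b_{d-1}\ge 1$. Let $A_{ -1}=\mathbf 0, A_0,A_1,\dots,A_d,A_{d+1}=\mathbf 0$ be $n\times n$ matrices with $A_0=I$, $A_1=A$, $A\mathbf j=k\mathbf j$ (where $\mathbf j$ is the all-ones column vector), the minimal polynomial of $A$ has degree at least $d+1$, $J=A_0+A_1+\cdots+A_d$ (with $J$ the all-ones matrix), and $AA_i=b_{i-1}A_{i-1}+a_iA_i+c_{i+1}A_{i+1}$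 for $0\le i\le d$. Let $\{x_{i,j}: 0\le i\le d,\,-1\le j\le d+1\}$ be numbers with $x_{i,-1}=x_{i,d+1}=0$ for $0\le i\le d$ and $x_{i+1,j}=(x_{i,j+1}-x_{i,j})b_j-(x_{i,j}-x_{i,j-1})c_j$ for $0\le i\le d-1$, $0\le j\le d$ (the values $x_{0,j}$, $0\le j\le d$, are arbitrary). Let $X=\sum_{j=0}^d x_{0,j}A_j$. Let $Q=(x'_{i,j})_{0\le i,j\le d}$ with $x'_{i,j}=x_{j,i}$. -}

module Defs where

open import Level using (0ℓ)
open import Data.Nat as ℕ using (ℕ; zero; suc; _∸_)
open import Data.Nat.Combinatorics using (_C_)
open import Data.Fin as Fin using (Fin; toℕ; punchIn)
open import Data.Product using (∃; _×_)
open import Data.Bool using (if_then_else_)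
open import Relation.Nullary using (¬_; Dec; yes; no)
open import Relation.Nullary.Decidable using (⌊_⌋)
open import Relation.Binary using (Rel; IsTotalOrder)
open import Algebra.Bundles using (CommutativeRing)

record OrderedField : Set₁ where
  field
    commutativeRing : CommutativeRing 0ℓ 0ℓ
  open CommutativeRing commutativeRing public
  field
    _≤F_         : Rel Carrier 0ℓ
    isTotalOrder : IsTotalOrder _≈_ _≤F_
    +-monoˡ-≤F   : ∀ {x y} z → x ≤F y → (x + z) ≤F (y + z)
    *-nonneg     : ∀ {x y} → 0# ≤F x → 0# ≤F y → 0# ≤F (x * y)
    0≉1          : ¬ (0# ≈ 1#)
    inv          : (x : Carrier) → ¬ (x ≈ 0#) → Carrier
    inv-correct  : (x : Carrier) (nz : ¬ (x ≈ 0#)) → (x * inv x nz) ≈ 1#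

module WithField (F : OrderedField) where
  open OrderedField F

  ι : ℕ → Carrier
  ι zero    = 0#
  ι (suc n) = 1# + ι n

  _^F_ : Carrier → ℕ → Carrier
  x ^F zero    = 1#
  x ^F (suc m) = x * (x ^F m)

  ∑≤ : ℕ → (ℕ → Carrier) → Carrier
  ∑≤ zero    f = f 0
  ∑≤ (suc m) f = ∑≤ m f + f (suc m)

  ∑FromTo : ℕ → ℕ → (ℕ → Carrier) → Carrier
  ∑FromTo lo hi f = ∑≤ hi (λ j → if ⌊ lo ℕ.≤? j ⌋ then f j else 0#)

  ∑Fin : (n : ℕ) → (Fin n → Carrier) → Carrier
  ∑Fin zero    f = 0#
  ∑Fin (suc n) f = f Fin.zero + ∑Fin n (λ i → f (Fin.suc i))

  Matrix : ℕ → Set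
  Matrix n = Fin n → Fin n → Carrier

  _≈M_ : ∀ {n} → Matrix n → Matrix n → Set
  M ≈M N = ∀ r s → M r s ≈ N r s

  0M : ∀ {n} → Matrix n
  0M r s = 0#

  IM : ∀ {n} → Matrix n
  IM r s = if ⌊ r Fin.≟ s ⌋ then 1# else 0#

  _+M_ : ∀ {n} → Matrix n → Matrix n → Matrix n
  (M +M N) r s = M r s + N r s

  _·M_ : ∀ {n} → Carrier → Matrix n → Matrix n
  (x ·M M) r s = x * M r s

  _*M_ : ∀ {n} → Matrix n → Matrix n → Matrix n
  _*M_ {n} M N r s = ∑Fin n (λ t → M r t * N t s)

  _^M_ : ∀ {n} → Matrix n → ℕ → Matrix n
  M ^M zero    = IM
  M ^M (suc m) = M *M (M ^M m)

  ∑M≤ : ∀ {n} → ℕ → (ℕ → Matrix n) → Matrix n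
  ∑M≤ zero    M = M 0
  ∑M≤ (suc m) M = ∑M≤ m M +M M (suc m)

  Invertible : ∀ {n} → Matrix n → Set
  Invertible M = ∃ λ N → ((M *M N) ≈M IM) × ((N *M M) ≈M IM)

  det : ∀ {n} → Matrix n → Carrier
  det {zero}  M = 1#
  det {suc n} M =
    ∑Fin (suc n) (λ j → ((- 1#) ^F toℕ j) * (M Fin.zero j *
                         det (λ r s → M (Fin.suc r) (punchIn j s))))

  replaceColE0 : ∀ {n} → Matrix (suc n) → ℕ → Matrix (suc n)
  replaceColE0 M j r s =
    if ⌊ toℕ s ℕ.≟ j ⌋ then (if ⌊ r Fin.≟ Fin.zero ⌋ then 1# else 0#) else M r s

  -- value at index j-1, with the convention that the value at index -1 is 0
  atPred : (ℕ → Carrier) → ℕ → Carrier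
  atPred f zero    = 0#
  atPred f (suc j) = f j

-- With B = A − kI, the three-term recurrences of the Aⱼ and of the xᵢⱼ give Bⁱ X = ∑ⱼ xᵢⱼ Aⱼ, hence
-- (∑ⱼ vⱼ Bʲ) X = ∑ᵣ (Q v)ᵣ Aᵣ for every coefficient vector v.  If det Q ≠ 0, Cramer's rule gives
-- z = (det Qⱼ / det Q)ⱼ with Q z = e₀, so ∑ⱼ zⱼ Bʲ is a left inverse of X; expanding the powers of
-- B = A − kI binomially turns it into ∑ᵢ yᵢ Aⁱ, and it is also a right inverse because every Aⱼ,
-- hence X, commutes with A.  Conversely, if X is invertible and Q w = 0, then ∑ⱼ wⱼ Bʲ kills X and
-- so vanishes; as A has no annihilating polynomial of degree ≤ d, its coefficients in powers of A
-- vanish, and these are unitriangular in w.  So Q has trivial kernel, and Gaussian elimination shows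
-- that then det Q ≠ 0.

module Submission where

open import Defs
open import Level using (0ℓ)
open import Data.Bool using (if_then_else_)
open import Data.Empty using (⊥; ⊥-elim)
open import Data.Fin using (Fin; toℕ; punchIn; punchOut)
import Data.Fin as Fin
import Data.Fin.Properties as Finₚ
open import Data.Nat using (ℕ; zero; suc; _≤_; _<_; _∸_)
import Data.Nat as ℕ
import Data.Nat.Properties as ℕₚ
open import Data.Nat.Combinatorics using (_C_)
import Data.Nat.Combinatorics as ℕᶜ
open import Data.Product using (_×_; _,_; proj₁; proj₂)
open import Data.Sum using (inj₁; inj₂)
open import Data.Unit using (⊤; tt)
open import Function using (_∘_)
open import Relation.Nullary using (¬_; Dec; yes; no)
open import Relation.Nullary.Decidable using (⌊_⌋; ¬¬-excluded-middle)
open import Relation.Binary using (IsTotalOrder; Setoid; tri<; tri≈; tri>)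
open import Relation.Binary.PropositionalEquality as ≡ using (_≡_; _≢_)
import Relation.Binary.Reasoning.Setoid as SetoidReasoning
import Algebra.Properties.Ring as RingProperties
import Algebra.Properties.CommutativeSemigroup as CommutativeSemigroupProperties

module _ (F : OrderedField) where

  open OrderedField F hiding (zero)
  open WithField F
  open RingProperties ring
  open CommutativeSemigroupProperties *-commutativeSemigroup
    using () renaming (x∙yz≈y∙xz to *-leftComm; interchange to *-interchange)
  open CommutativeSemigroupProperties +-commutativeSemigroup
    using () renaming (interchange to +-interchange)
  open IsTotalOrder isTotalOrder
    using () renaming (reflexive to ≤F-reflexive; trans to ≤F-trans; antisym to ≤F-antisym; total to ≤F-total)
  open SetoidReasoning setoid

  ι-homo-+ : ∀ m p → ι (m ℕ.+ p) ≈ ι m + ι p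
  ι-homo-+ zero    p = sym (+-identityˡ (ι p))
  ι-homo-+ (suc m) p = trans (+-congˡ (ι-homo-+ m p)) (sym (+-assoc 1# (ι m) (ι p)))

  -- If 1 ≤ 0 then 0 ≤ -1, hence 0 ≤ (-1)(-1) = 1.
  0≤1 : 0# ≤F 1#
  0≤1 with ≤F-total 0# 1#
  ... | inj₁ 0≤1 = 0≤1
  ... | inj₂ 1≤0 =
    ≤F-trans (*-nonneg 0≤-1 0≤-1) (≤F-reflexive (trans (-1*x≈-x (- 1#)) (-‿involutive 1#)))
    where
    0≤-1 : 0# ≤F (- 1#)
    0≤-1 = ≤F-trans (≤F-reflexive (sym (-‿inverseʳ 1#)))
             (≤F-trans (+-monoˡ-≤F (- 1#) 1≤0) (≤F-reflexive (+-identityˡ (- 1#))))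

  1≤x⇒x≉0 : ∀ {x} → 1# ≤F x → ¬ (x ≈ 0#)
  1≤x⇒x≉0 1≤x x≈0 = 0≉1 (≤F-antisym 0≤1 (≤F-trans 1≤x (≤F-reflexive x≈0)))

  1≤-of-increasing : ∀ d (f : ℕ → Carrier) → 1# ≤F f 1 → (∀ i → 1 ≤ i → i < d → f i ≤F f (suc i)) →
    ∀ i → 1 ≤ i → i ≤ d → 1# ≤F f i
  1≤-of-increasing d f 1≤f₁ increasing (suc zero)    _ _       = 1≤f₁
  1≤-of-increasing d f 1≤f₁ increasing (suc (suc i)) _ 2+i≤d =
    ≤F-trans (1≤-of-increasing d f 1≤f₁ increasing (suc i) (ℕ.s≤s ℕ.z≤n) (ℕₚ.<⇒≤ 2+i≤d))
             (increasing (suc i) (ℕ.s≤s ℕ.z≤n) 2+i≤d)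

  [-x]^n≈[-1]^n*x^n : ∀ x n → (- x) ^F n ≈ ((- 1#) ^F n) * (x ^F n)
  [-x]^n≈[-1]^n*x^n x zero    = sym (*-identityˡ 1#)
  [-x]^n≈[-1]^n*x^n x (suc n) =
    trans (*-cong (sym (-1*x≈-x x)) ([-x]^n≈[-1]^n*x^n x n)) (*-interchange (- 1#) x _ _)

  inverseˡ : ∀ x (x≉0 : ¬ (x ≈ 0#)) → inv x x≉0 * x ≈ 1#
  inverseˡ x x≉0 = trans (*-comm _ x) (inv-correct x x≉0)

  *-cancelˡ-≉0 : ∀ {c x y} → ¬ (c ≈ 0#) → c * x ≈ c * y → x ≈ y
  *-cancelˡ-≉0 {c} {x} {y} c≉0 cx≈cy = begin
    x                       ≈⟨ *-identityˡ x ⟨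
    1# * x                  ≈⟨ *-congʳ (inverseˡ c c≉0) ⟨
    (inv c c≉0 * c) * x     ≈⟨ *-assoc _ c x ⟩
    inv c c≉0 * (c * x)     ≈⟨ *-congˡ cx≈cy ⟩
    inv c c≉0 * (c * y)     ≈⟨ *-assoc _ c y ⟨
    (inv c c≉0 * c) * y     ≈⟨ *-congʳ (inverseˡ c c≉0) ⟩
    1# * y                  ≈⟨ *-identityˡ y ⟩
    y                       ∎

  *-linear : ∀ s α β x y → s * (α * x + β * y) ≈ α * (s * x) + β * (s * y)
  *-linear s α β x y = trans (distribˡ s _ _) (+-cong (*-leftComm s α x) (*-leftComm s β y))

  x≈0⇒s*[x*y]≈0 : ∀ s {x} y → x ≈ 0# → s * (x * y) ≈ 0#
  x≈0⇒s*[x*y]≈0 s y x≈0 = trans (*-congˡ (trans (*-congʳ x≈0) (zeroˡ y))) (zeroʳ s)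

  y≈0⇒s*[x*y]≈0 : ∀ s x {y} → y ≈ 0# → s * (x * y) ≈ 0#
  y≈0⇒s*[x*y]≈0 s x y≈0 = trans (*-congˡ (trans (*-congˡ y≈0) (zeroʳ x))) (zeroʳ s)

  -- Finite sums

  ∑Fin-cong : ∀ n {f g : Fin n → Carrier} → (∀ i → f i ≈ g i) → ∑Fin n f ≈ ∑Fin n g
  ∑Fin-cong zero    f≈g = refl
  ∑Fin-cong (suc n) f≈g = +-cong (f≈g Fin.zero) (∑Fin-cong n (f≈g ∘ Fin.suc))

  ∑Fin-zero : ∀ n {f : Fin n → Carrier} → (∀ i → f i ≈ 0#) → ∑Fin n f ≈ 0#
  ∑Fin-zero zero    f≈0 = refl
  ∑Fin-zero (suc n) f≈0 = trans (+-cong (f≈0 Fin.zero) (∑Fin-zero n (f≈0 ∘ Fin.suc))) (+-identityˡ 0#)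

  ∑Fin-distrib-+ : ∀ n (f g : Fin n → Carrier) → ∑Fin n (λ i → f i + g i) ≈ ∑Fin n f + ∑Fin n g
  ∑Fin-distrib-+ zero    f g = sym (+-identityˡ 0#)
  ∑Fin-distrib-+ (suc n) f g = trans (+-congˡ (∑Fin-distrib-+ n _ _)) (+-interchange _ _ _ _)

  *-distribˡ-∑Fin : ∀ n c (f : Fin n → Carrier) → c * ∑Fin n f ≈ ∑Fin n (λ i → c * f i)
  *-distribˡ-∑Fin zero    c f = zeroʳ c
  *-distribˡ-∑Fin (suc n) c f = trans (distribˡ c _ _) (+-congˡ (*-distribˡ-∑Fin n c _))

  *-distribʳ-∑Fin : ∀ n c (f : Fin n → Carrier) → ∑Fin n f * c ≈ ∑Fin n (λ i → f i * c)
  *-distribʳ-∑Fin zero    c f = zeroˡ c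
  *-distribʳ-∑Fin (suc n) c f = trans (distribʳ c _ _) (+-congˡ (*-distribʳ-∑Fin n c _))

  -‿distrib-∑Fin : ∀ n (f : Fin n → Carrier) → - ∑Fin n f ≈ ∑Fin n (λ i → - f i)
  -‿distrib-∑Fin zero    f = -0#≈0#
  -‿distrib-∑Fin (suc n) f = trans (sym (-‿+-comm _ _)) (+-congˡ (-‿distrib-∑Fin n _))

  ∑Fin-linear : ∀ n α β (f g : Fin n → Carrier) →
    ∑Fin n (λ j → α * f j + β * g j) ≈ α * ∑Fin n f + β * ∑Fin n g
  ∑Fin-linear n α β f g =
    trans (∑Fin-distrib-+ n _ _) (sym (+-cong (*-distribˡ-∑Fin n α f) (*-distribˡ-∑Fin n β g)))

  ∑Fin-comm : ∀ m n (f : Fin m → Fin n → Carrier) →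
    ∑Fin m (λ i → ∑Fin n (f i)) ≈ ∑Fin n (λ j → ∑Fin m (λ i → f i j))
  ∑Fin-comm zero    n f = sym (∑Fin-zero n (λ _ → refl))
  ∑Fin-comm (suc m) n f = trans (+-congˡ (∑Fin-comm m n _)) (sym (∑Fin-distrib-+ n _ _))

  ∑Fin-single : ∀ n (s : Fin n) (f : Fin n → Carrier) → (∀ t → t ≢ s → f t ≈ 0#) → ∑Fin n f ≈ f s
  ∑Fin-single (suc n) Fin.zero    f f≈0 =
    trans (+-congˡ (∑Fin-zero n (λ i → f≈0 (Fin.suc i) (λ ())))) (+-identityʳ _)
  ∑Fin-single (suc n) (Fin.suc s) f f≈0 =
    trans (+-congʳ (f≈0 Fin.zero (λ ())))
      (trans (+-identityˡ _) (∑Fin-single n s _ (λ t t≢s → f≈0 (Fin.suc t) (t≢s ∘ Finₚ.suc-injective))))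

  ∑Fin-init-last : ∀ n (f : Fin (suc n) → Carrier) →
    ∑Fin (suc n) f ≈ ∑Fin n (f ∘ Fin.inject₁) + f (Fin.fromℕ n)
  ∑Fin-init-last zero    f = trans (+-identityʳ _) (sym (+-identityˡ _))
  ∑Fin-init-last (suc n) f = trans (+-congˡ (∑Fin-init-last n (f ∘ Fin.suc))) (sym (+-assoc _ _ _))

  ∑≤-cong : ∀ m {f g : ℕ → Carrier} → (∀ j → j ≤ m → f j ≈ g j) → ∑≤ m f ≈ ∑≤ m g
  ∑≤-cong zero    f≈g = f≈g 0 ℕ.z≤n
  ∑≤-cong (suc m) f≈g = +-cong (∑≤-cong m (λ j j≤m → f≈g j (ℕₚ.m≤n⇒m≤1+n j≤m))) (f≈g (suc m) ℕₚ.≤-refl)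

  ∑≤-zero : ∀ m {f : ℕ → Carrier} → (∀ j → j ≤ m → f j ≈ 0#) → ∑≤ m f ≈ 0#
  ∑≤-zero m f≈0 = trans (∑≤-cong m f≈0) (zeros m)
    where
    zeros : ∀ m → ∑≤ m (λ _ → 0#) ≈ 0#
    zeros zero    = refl
    zeros (suc m) = trans (+-congʳ (zeros m)) (+-identityˡ 0#)

  ∑≤-distrib-+ : ∀ m (f g : ℕ → Carrier) → ∑≤ m (λ i → f i + g i) ≈ ∑≤ m f + ∑≤ m g
  ∑≤-distrib-+ zero    f g = refl
  ∑≤-distrib-+ (suc m) f g = trans (+-congʳ (∑≤-distrib-+ m f g)) (+-interchange _ _ _ _)

  *-distribˡ-∑≤ : ∀ m c (f : ℕ → Carrier) → c * ∑≤ m f ≈ ∑≤ m (λ i → c * f i)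
  *-distribˡ-∑≤ zero    c f = refl
  *-distribˡ-∑≤ (suc m) c f = trans (distribˡ c _ _) (+-congʳ (*-distribˡ-∑≤ m c f))

  *-distribʳ-∑≤ : ∀ m c (f : ℕ → Carrier) → ∑≤ m f * c ≈ ∑≤ m (λ i → f i * c)
  *-distribʳ-∑≤ zero    c f = refl
  *-distribʳ-∑≤ (suc m) c f = trans (distribʳ c _ _) (+-congʳ (*-distribʳ-∑≤ m c f))

  ∑≤-head : ∀ m (f : ℕ → Carrier) → ∑≤ (suc m) f ≈ f 0 + ∑≤ m (f ∘ suc)
  ∑≤-head zero    f = refl
  ∑≤-head (suc m) f = trans (+-congʳ (∑≤-head m f)) (+-assoc _ _ _)

  ∑≤-comm : ∀ m p (f : ℕ → ℕ → Carrier) →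
    ∑≤ m (λ i → ∑≤ p (f i)) ≈ ∑≤ p (λ j → ∑≤ m (λ i → f i j))
  ∑≤-comm zero    p f = refl
  ∑≤-comm (suc m) p f = trans (+-congʳ (∑≤-comm m p f)) (sym (∑≤-distrib-+ p _ _))

  ∑≤-single : ∀ m i (f : ℕ → Carrier) → i ≤ m → (∀ j → j ≤ m → j ≢ i → f j ≈ 0#) → ∑≤ m f ≈ f i
  ∑≤-single zero    .zero f ℕ.z≤n f≈0 = refl
  ∑≤-single (suc m) i     f i≤1+m f≈0 with i ℕ.≟ suc m
  ... | yes ≡.refl =
    trans (+-congʳ (∑≤-zero m (λ j j≤m → f≈0 j (ℕₚ.m≤n⇒m≤1+n j≤m) (ℕₚ.<⇒≢ (ℕ.s≤s j≤m))))) (+-identityˡ _)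
  ... | no  i≢1+m =
    trans (+-cong (∑≤-single m i f (ℕₚ.≤-pred (ℕₚ.≤∧≢⇒< i≤1+m i≢1+m))
                                   (λ j j≤m → f≈0 j (ℕₚ.m≤n⇒m≤1+n j≤m)))
                  (f≈0 (suc m) ℕₚ.≤-refl (i≢1+m ∘ ≡.sym)))
          (+-identityʳ _)

  ∑≤≈∑Fin : ∀ m (f : ℕ → Carrier) → ∑≤ m f ≈ ∑Fin (suc m) (f ∘ toℕ)
  ∑≤≈∑Fin zero    f = sym (+-identityʳ _)
  ∑≤≈∑Fin (suc m) f = sym (begin
    ∑Fin (suc (suc m)) (f ∘ toℕ)
      ≈⟨ ∑Fin-init-last (suc m) (f ∘ toℕ) ⟩
    ∑Fin (suc m) (f ∘ toℕ ∘ Fin.inject₁) + f (toℕ (Fin.fromℕ (suc m)))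
      ≈⟨ +-cong (∑Fin-cong (suc m) (reflexive ∘ ≡.cong f ∘ Finₚ.toℕ-inject₁))
                (reflexive (≡.cong f (Finₚ.toℕ-fromℕ (suc m)))) ⟩
    ∑Fin (suc m) (f ∘ toℕ) + f (suc m)
      ≈⟨ +-congʳ (∑≤≈∑Fin m f) ⟨
    ∑≤ (suc m) f ∎)

  ∑≤-shiftDown : ∀ m (v H : ℕ → Carrier) → v m * H (suc m) ≈ 0# →
    ∑≤ m (λ i → v i * H (suc i)) ≈ ∑≤ m (λ i → atPred v i * H i)
  ∑≤-shiftDown zero    v H last≈0 = trans last≈0 (sym (zeroˡ (H 0)))
  ∑≤-shiftDown (suc m) v H last≈0 = begin
    ∑≤ m (λ i → v i * H (suc i)) + v (suc m) * H (suc (suc m))  ≈⟨ trans (+-congˡ last≈0) (+-identityʳ _) ⟩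
    ∑≤ m (λ i → v i * H (suc i))                                 ≈⟨ trans (+-congʳ (zeroˡ (H 0))) (+-identityˡ _) ⟨
    0# * H 0 + ∑≤ m (λ i → v i * H (suc i))                      ≈⟨ ∑≤-head m (λ i → atPred v i * H i) ⟨
    ∑≤ (suc m) (λ i → atPred v i * H i)                          ∎

  -- Summation by parts against a three-term recurrence.
  ∑≤-threeTerm : ∀ m (u α β γ G : ℕ → Carrier) → β m ≈ 0# → γ (suc m) ≈ 0# →
    ∑≤ m (λ j → u j * ((atPred (λ i → β i * G i) j + α j * G j) + γ (suc j) * G (suc j)))
      ≈ ∑≤ m (λ j → ((u (suc j) * β j + u j * α j) + atPred u j * γ j) * G j)
  ∑≤-threeTerm m u α β γ G β[m]≈0 γ[m+1]≈0 = begin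
    ∑≤ m (λ j → u j * ((atPred βG j + α j * G j) + γ (suc j) * G (suc j)))
      ≈⟨ ∑≤-cong m (λ j _ → trans (distribˡ _ _ _) (+-congʳ (distribˡ _ _ _))) ⟩
    ∑≤ m (λ j → (u j * atPred βG j + u j * (α j * G j)) + u j * (γ (suc j) * G (suc j)))
      ≈⟨ trans (∑≤-distrib-+ m _ _) (+-congʳ (∑≤-distrib-+ m _ _)) ⟩
    (∑≤ m (λ j → u j * atPred βG j) + ∑≤ m (λ j → u j * (α j * G j))) + ∑≤ m (λ j → u j * (γ (suc j) * G (suc j)))
      ≈⟨ +-cong (+-cong lower (∑≤-cong m (λ j _ → sym (*-assoc _ _ _)))) upper ⟩
    (∑≤ m (λ j → (u (suc j) * β j) * G j) + ∑≤ m (λ j → (u j * α j) * G j)) + ∑≤ m (λ j → (atPred u j * γ j) * G j)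
      ≈⟨ trans (∑≤-distrib-+ m _ _) (+-congʳ (∑≤-distrib-+ m _ _)) ⟨
    ∑≤ m (λ j → ((u (suc j) * β j) * G j + (u j * α j) * G j) + (atPred u j * γ j) * G j)
      ≈⟨ ∑≤-cong m (λ j _ → trans (distribʳ _ _ _) (+-congʳ (distribʳ _ _ _))) ⟨
    ∑≤ m (λ j → ((u (suc j) * β j + u j * α j) + atPred u j * γ j) * G j) ∎
    where
    βG γG : ℕ → Carrier
    βG i = β i * G i
    γG i = γ i * G i
    lower : ∑≤ m (λ j → u j * atPred βG j) ≈ ∑≤ m (λ j → (u (suc j) * β j) * G j)
    lower = begin
      ∑≤ m (λ j → u j * atPred βG j)        ≈⟨ ∑≤-cong m (λ j _ → *-comm _ _) ⟩
      ∑≤ m (λ j → atPred βG j * u j)        ≈⟨ ∑≤-shiftDown m βG u (trans (*-congʳ (trans (*-congʳ β[m]≈0) (zeroˡ _))) (zeroˡ _)) ⟨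
      ∑≤ m (λ j → βG j * u (suc j))         ≈⟨ ∑≤-cong m (λ j _ → trans (*-comm _ _) (sym (*-assoc _ _ _))) ⟩
      ∑≤ m (λ j → (u (suc j) * β j) * G j)  ∎
    upper : ∑≤ m (λ j → u j * (γ (suc j) * G (suc j))) ≈ ∑≤ m (λ j → (atPred u j * γ j) * G j)
    upper = trans (∑≤-shiftDown m u γG (trans (*-congˡ (trans (*-congʳ γ[m+1]≈0) (zeroˡ _))) (zeroʳ _)))
                  (∑≤-cong m (λ j _ → sym (*-assoc _ _ _)))

  -- Downward induction: the last equation gives w m = 0, then w (m-1) = 0, and so on.
  unitriangular-injective : ∀ m (w : ℕ → Carrier) (β : ℕ → ℕ → Carrier) →
    (∀ {j i} → j < i → β j i ≈ 0#) → (∀ i → β i i ≈ 1#) →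
    (∀ i → i ≤ m → ∑≤ m (λ j → w j * β j i) ≈ 0#) → ∀ i → i ≤ m → w i ≈ 0#
  unitriangular-injective m w β below above sums≈0 i i≤m = downFrom m i i≤m (ℕₚ.m≤n+m m i)
    where
    solve : ∀ i → i ≤ m → (∀ j → i < j → j ≤ m → w j ≈ 0#) → w i ≈ 0#
    solve i i≤m later≈0 = begin
      w i                             ≈⟨ trans (*-congˡ (above i)) (*-identityʳ (w i)) ⟨
      w i * β i i                     ≈⟨ ∑≤-single m i _ i≤m off ⟨
      ∑≤ m (λ j → w j * β j i)        ≈⟨ sums≈0 i i≤m ⟩
      0#                              ∎
      where
      off : ∀ j → j ≤ m → j ≢ i → w j * β j i ≈ 0#
      off j j≤m j≢i with ℕₚ.<-cmp j i
      ... | tri< j<i _ _ = trans (*-congˡ (below j<i)) (zeroʳ _)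
      ... | tri≈ _ j≡i _ = ⊥-elim (j≢i j≡i)
      ... | tri> _ _ i<j = trans (*-congʳ (later≈0 j i<j j≤m)) (zeroˡ _)
    downFrom : ∀ t i → i ≤ m → m ≤ i ℕ.+ t → w i ≈ 0#
    downFrom zero    i i≤m m≤i+0 = solve i i≤m λ j i<j j≤m →
      ⊥-elim (ℕₚ.<-irrefl ≡.refl (ℕₚ.≤-<-trans (ℕₚ.≤-trans m≤i+0 (ℕₚ.≤-reflexive (ℕₚ.+-identityʳ i)))
                                               (ℕₚ.<-≤-trans i<j j≤m)))
    downFrom (suc t) i i≤m m≤i+1+t = solve i i≤m λ j i<j j≤m →
      downFrom t j j≤m (ℕₚ.≤-trans m≤i+1+t (ℕₚ.≤-trans (ℕₚ.≤-reflexive (ℕₚ.+-suc i t)) (ℕₚ.+-monoˡ-≤ t i<j)))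

  -- Square matrices

  matrixSetoid : ℕ → Setoid 0ℓ 0ℓ
  matrixSetoid n = record
    { Carrier       = Matrix n
    ; _≈_           = _≈M_
    ; isEquivalence = record
      { refl  = λ r s → refl
      ; sym   = λ M≈N r s → sym (M≈N r s)
      ; trans = λ M≈N N≈P r s → trans (M≈N r s) (N≈P r s)
      }
    }

  module ≈M {n} = Setoid (matrixSetoid n)

  lincomb : ∀ {n} → ℕ → (ℕ → Carrier) → (ℕ → Matrix n) → Matrix n
  lincomb m u N = ∑M≤ m (λ i → u i ·M N i)

  module _ {n : ℕ} where

    +M-cong : {M M′ N N′ : Matrix n} → M ≈M M′ → N ≈M N′ → (M +M N) ≈M (M′ +M N′)
    +M-cong M≈M′ N≈N′ r s = +-cong (M≈M′ r s) (N≈N′ r s)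

    ·M-cong : ∀ {x y} {M N : Matrix n} → x ≈ y → M ≈M N → (x ·M M) ≈M (y ·M N)
    ·M-cong x≈y M≈N r s = *-cong x≈y (M≈N r s)

    *M-cong : {M M′ N N′ : Matrix n} → M ≈M M′ → N ≈M N′ → (M *M N) ≈M (M′ *M N′)
    *M-cong M≈M′ N≈N′ r s = ∑Fin-cong n (λ t → *-cong (M≈M′ r t) (N≈N′ t s))

    *M-assoc : (M N P : Matrix n) → ((M *M N) *M P) ≈M (M *M (N *M P))
    *M-assoc M N P r s = begin
      ∑Fin n (λ t → ∑Fin n (λ u → M r u * N u t) * P t s)
        ≈⟨ ∑Fin-cong n (λ t → *-distribʳ-∑Fin n (P t s) _) ⟩
      ∑Fin n (λ t → ∑Fin n (λ u → (M r u * N u t) * P t s))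
        ≈⟨ ∑Fin-comm n n _ ⟩
      ∑Fin n (λ u → ∑Fin n (λ t → (M r u * N u t) * P t s))
        ≈⟨ ∑Fin-cong n (λ u → trans (∑Fin-cong n (λ t → *-assoc _ _ _)) (sym (*-distribˡ-∑Fin n (M r u) _))) ⟩
      ∑Fin n (λ u → M r u * ∑Fin n (λ t → N u t * P t s)) ∎

    IM-diagonal : ∀ r → IM {n} r r ≈ 1#
    IM-diagonal r with r Fin.≟ r
    ... | yes _   = refl
    ... | no  r≢r = ⊥-elim (r≢r ≡.refl)

    IM-offDiagonal : ∀ {r s} → r ≢ s → IM {n} r s ≈ 0#
    IM-offDiagonal {r} {s} r≢s with r Fin.≟ s
    ... | yes r≡s = ⊥-elim (r≢s r≡s)
    ... | no  _   = refl

    *M-identityˡ : (M : Matrix n) → (IM *M M) ≈M M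
    *M-identityˡ M r s =
      trans (∑Fin-single n r _ (λ t t≢r → trans (*-congʳ (IM-offDiagonal (t≢r ∘ ≡.sym))) (zeroˡ _)))
            (trans (*-congʳ (IM-diagonal r)) (*-identityˡ _))

    *M-identityʳ : (M : Matrix n) → (M *M IM) ≈M M
    *M-identityʳ M r s =
      trans (∑Fin-single n s _ (λ t t≢s → trans (*-congˡ (IM-offDiagonal t≢s)) (zeroʳ _)))
            (trans (*-congˡ (IM-diagonal s)) (*-identityʳ _))

    *M-zeroˡ : (M : Matrix n) → (0M *M M) ≈M 0M
    *M-zeroˡ M r s = ∑Fin-zero n (λ t → zeroˡ _)

    *M-distribˡ-+M : (M N P : Matrix n) → (M *M (N +M P)) ≈M ((M *M N) +M (M *M P))
    *M-distribˡ-+M M N P r s = trans (∑Fin-cong n (λ t → distribˡ _ _ _)) (∑Fin-distrib-+ n _ _)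

    *M-distribʳ-+M : (M N P : Matrix n) → ((M +M N) *M P) ≈M ((M *M P) +M (N *M P))
    *M-distribʳ-+M M N P r s = trans (∑Fin-cong n (λ t → distribʳ _ _ _)) (∑Fin-distrib-+ n _ _)

    *M-·M-comm : (M : Matrix n) (x : Carrier) (N : Matrix n) → (M *M (x ·M N)) ≈M (x ·M (M *M N))
    *M-·M-comm M x N r s = trans (∑Fin-cong n (λ t → *-leftComm _ _ _)) (sym (*-distribˡ-∑Fin n x _))

    ·M-*M-assoc : (x : Carrier) (M N : Matrix n) → ((x ·M M) *M N) ≈M (x ·M (M *M N))
    ·M-*M-assoc x M N r s = trans (∑Fin-cong n (λ t → *-assoc _ _ _)) (sym (*-distribˡ-∑Fin n x _))

    ∑M≤-entry : ∀ m (M : ℕ → Matrix n) r s → ∑M≤ m M r s ≡ ∑≤ m (λ i → M i r s)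
    ∑M≤-entry zero    M r s = ≡.refl
    ∑M≤-entry (suc m) M r s = ≡.cong (_+ M (suc m) r s) (∑M≤-entry m M r s)

    lincomb-entry : ∀ m (u : ℕ → Carrier) (N : ℕ → Matrix n) r s →
      lincomb m u N r s ≈ ∑≤ m (λ i → u i * N i r s)
    lincomb-entry m u N r s = reflexive (∑M≤-entry m _ r s)

    ∑M≤-cong : ∀ m {M N : ℕ → Matrix n} → (∀ i → i ≤ m → M i ≈M N i) → ∑M≤ m M ≈M ∑M≤ m N
    ∑M≤-cong zero    M≈N = M≈N 0 ℕ.z≤n
    ∑M≤-cong (suc m) M≈N = +M-cong (∑M≤-cong m (λ i i≤m → M≈N i (ℕₚ.m≤n⇒m≤1+n i≤m))) (M≈N (suc m) ℕₚ.≤-refl)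

    lincomb-cong : ∀ m {u v : ℕ → Carrier} {M N : ℕ → Matrix n} →
      (∀ i → i ≤ m → u i ≈ v i) → (∀ i → i ≤ m → M i ≈M N i) → lincomb m u M ≈M lincomb m v N
    lincomb-cong m u≈v M≈N = ∑M≤-cong m (λ i i≤m → ·M-cong (u≈v i i≤m) (M≈N i i≤m))

    *M-lincomb : ∀ m (M : Matrix n) (u : ℕ → Carrier) (N : ℕ → Matrix n) →
      (M *M lincomb m u N) ≈M lincomb m u (λ i → M *M N i)
    *M-lincomb zero    M u N = *M-·M-comm M (u 0) (N 0)
    *M-lincomb (suc m) M u N =
      ≈M.trans (*M-distribˡ-+M M _ _) (+M-cong (*M-lincomb m M u N) (*M-·M-comm M _ _))

    lincomb-*M : ∀ m (u : ℕ → Carrier) (N : ℕ → Matrix n) (M : Matrix n) →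
      (lincomb m u N *M M) ≈M lincomb m u (λ i → N i *M M)
    lincomb-*M zero    u N M = ·M-*M-assoc (u 0) (N 0) M
    lincomb-*M (suc m) u N M =
      ≈M.trans (*M-distribʳ-+M _ _ M) (+M-cong (lincomb-*M m u N M) (·M-*M-assoc _ _ M))

    lincomb-lincomb : ∀ m p (v : ℕ → Carrier) (β : ℕ → ℕ → Carrier) (N : ℕ → Matrix n) →
      lincomb m v (λ j → lincomb p (β j) N) ≈M lincomb p (λ i → ∑≤ m (λ j → v j * β j i)) N
    lincomb-lincomb m p v β N r s = begin
      lincomb m v (λ j → lincomb p (β j) N) r s           ≈⟨ lincomb-entry m v _ r s ⟩
      ∑≤ m (λ j → v j * lincomb p (β j) N r s)            ≈⟨ ∑≤-cong m (λ j _ → *-congˡ (lincomb-entry p (β j) N r s)) ⟩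
      ∑≤ m (λ j → v j * ∑≤ p (λ i → β j i * N i r s))     ≈⟨ ∑≤-cong m (λ j _ → *-distribˡ-∑≤ p (v j) _) ⟩
      ∑≤ m (λ j → ∑≤ p (λ i → v j * (β j i * N i r s)))   ≈⟨ ∑≤-comm m p _ ⟩
      ∑≤ p (λ i → ∑≤ m (λ j → v j * (β j i * N i r s)))   ≈⟨ ∑≤-cong p (λ i _ → trans (∑≤-cong m (λ j _ → sym (*-assoc _ _ _)))
                                                                                    (sym (*-distribʳ-∑≤ m (N i r s) _))) ⟩
      ∑≤ p (λ i → ∑≤ m (λ j → v j * β j i) * N i r s)     ≈⟨ lincomb-entry p _ N r s ⟨
      lincomb p (λ i → ∑≤ m (λ j → v j * β j i)) N r s    ∎

    lincomb-+M-·M : ∀ m (u : ℕ → Carrier) t (v : ℕ → Carrier) (N : ℕ → Matrix n) →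
      (lincomb m u N +M (t ·M lincomb m v N)) ≈M lincomb m (λ i → u i + t * v i) N
    lincomb-+M-·M m u t v N r s = begin
      lincomb m u N r s + t * lincomb m v N r s
        ≈⟨ +-cong (lincomb-entry m u N r s) (trans (*-congˡ (lincomb-entry m v N r s)) (*-distribˡ-∑≤ m t _)) ⟩
      ∑≤ m (λ i → u i * N i r s) + ∑≤ m (λ i → t * (v i * N i r s))
        ≈⟨ ∑≤-distrib-+ m _ _ ⟨
      ∑≤ m (λ i → u i * N i r s + t * (v i * N i r s))
        ≈⟨ ∑≤-cong m (λ i _ → trans (+-congˡ (sym (*-assoc t _ _))) (sym (distribʳ _ _ _))) ⟩
      ∑≤ m (λ i → (u i + t * v i) * N i r s)
        ≈⟨ lincomb-entry m _ N r s ⟨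
      lincomb m (λ i → u i + t * v i) N r s ∎

    +·IM-*M : (A : Matrix n) (t : Carrier) (N : Matrix n) → ((A +M (t ·M IM)) *M N) ≈M ((A *M N) +M (t ·M N))
    +·IM-*M A t N = ≈M.trans (*M-distribʳ-+M A _ N)
      (+M-cong ≈M.refl (≈M.trans (·M-*M-assoc t IM N) (·M-cong refl (*M-identityˡ N))))

    Commute : Matrix n → Matrix n → Set
    Commute M N = (M *M N) ≈M (N *M M)

    commute-sym : ∀ {M N} → Commute M N → Commute N M
    commute-sym = ≈M.sym

    commute-cong : ∀ {M N N′} → N ≈M N′ → Commute M N → Commute M N′
    commute-cong {M} N≈N′ MN = ≈M.trans (*M-cong ≈M.refl (≈M.sym N≈N′)) (≈M.trans MN (*M-cong N≈N′ (≈M.refl {x = M})))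

    commute-cancel-+M : ∀ {M N P} → Commute M N → Commute M (N +M P) → Commute M P
    commute-cancel-+M {M} {N} {P} MN MNP r s = +-cancelˡ ((M *M N) r s) _ _ (begin
      (M *M N) r s + (M *M P) r s   ≈⟨ *M-distribˡ-+M M N P r s ⟨
      (M *M (N +M P)) r s           ≈⟨ MNP r s ⟩
      ((N +M P) *M M) r s           ≈⟨ *M-distribʳ-+M N P M r s ⟩
      (N *M M) r s + (P *M M) r s   ≈⟨ +-congʳ (MN r s) ⟨
      (M *M N) r s + (P *M M) r s   ∎)

    commute-IM : ∀ M → Commute M IM
    commute-IM M = ≈M.trans (*M-identityʳ M) (≈M.sym (*M-identityˡ M))

    commute-+M : ∀ {M N P} → Commute M N → Commute M P → Commute M (N +M P)
    commute-+M {M} {N} {P} MN MP =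
      ≈M.trans (*M-distribˡ-+M M N P) (≈M.trans (+M-cong MN MP) (≈M.sym (*M-distribʳ-+M N P M)))

    commute-·M : ∀ {M N} t → Commute M N → Commute M (t ·M N)
    commute-·M {M} {N} t MN = ≈M.trans (*M-·M-comm M t N) (≈M.trans (·M-cong refl MN) (≈M.sym (·M-*M-assoc t N M)))

    commute-*M : ∀ {M N P} → Commute M N → Commute M P → Commute M (N *M P)
    commute-*M {M} {N} {P} MN MP =
      ≈M.trans (≈M.sym (*M-assoc M N P)) (≈M.trans (*M-cong MN ≈M.refl) (≈M.trans (*M-assoc N M P)
        (≈M.trans (*M-cong ≈M.refl MP) (≈M.sym (*M-assoc N P M)))))

    commute-^M : ∀ {M N} → Commute M N → ∀ i → Commute M (N ^M i)
    commute-^M {M} MN zero    = commute-IM M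
    commute-^M     MN (suc i) = commute-*M MN (commute-^M MN i)

    commute-lincomb : ∀ {M} m (u : ℕ → Carrier) (N : ℕ → Matrix n) →
      (∀ i → i ≤ m → Commute M (N i)) → Commute M (lincomb m u N)
    commute-lincomb zero    u N MN = commute-·M (u 0) (MN 0 ℕ.z≤n)
    commute-lincomb (suc m) u N MN = commute-+M
      (commute-lincomb m u N (λ i i≤m → MN i (ℕₚ.m≤n⇒m≤1+n i≤m)))
      (commute-·M (u (suc m)) (MN (suc m) ℕₚ.≤-refl))

    commute-cancel : ∀ {M N} {t} → ¬ (t ≈ 0#) → Commute M (t ·M N) → Commute M N
    commute-cancel {M} {N} t≉0 MtN r s = *-cancelˡ-≉0 t≉0 (begin
      _ * (M *M N) r s      ≈⟨ *M-·M-comm M _ N r s ⟨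
      (M *M (_ ·M N)) r s   ≈⟨ MtN r s ⟩
      ((_ ·M N) *M M) r s   ≈⟨ ·M-*M-assoc _ N M r s ⟩
      _ * (N *M M) r s      ∎)

  -- Determinants

  sgn : ∀ {n} → Fin n → Carrier
  sgn j = (- 1#) ^F toℕ j

  sgn-suc : ∀ {n} (j : Fin n) x → sgn (Fin.suc j) * x ≈ - (sgn j * x)
  sgn-suc j x = trans (*-assoc (- 1#) _ x) (-1*x≈-x _)

  minor : ∀ {n} → Matrix (suc n) → Fin (suc n) → Matrix n
  minor M j r s = M (Fin.suc r) (punchIn j s)

  laplaceTerm : ∀ {n} → Matrix (suc n) → Fin (suc n) → Carrier
  laplaceTerm M j = sgn j * (M Fin.zero j * det (minor M j))

  det-cong : ∀ {n} {M N : Matrix n} → M ≈M N → det M ≈ det N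
  det-cong {zero}  M≈N = refl
  det-cong {suc n} {M} {N} M≈N = ∑Fin-cong (suc n) {laplaceTerm M} {laplaceTerm N} λ j →
    *-congˡ (*-cong (M≈N Fin.zero j) (det-cong (λ r s → M≈N (Fin.suc r) (punchIn j s))))

  det-zeroColumn : ∀ {n} (M : Matrix n) c → (∀ r → M r c ≈ 0#) → det M ≈ 0#
  det-zeroColumn {suc n} M c Mc≈0 = ∑Fin-zero (suc n) term
    where
    term : ∀ j → sgn j * (M Fin.zero j * det (minor M j)) ≈ 0#
    term j with j Fin.≟ c
    ... | yes ≡.refl = x≈0⇒s*[x*y]≈0 (sgn j) _ (Mc≈0 Fin.zero)
    ... | no  j≢c    = y≈0⇒s*[x*y]≈0 (sgn j) _ (det-zeroColumn (minor M j) (punchOut j≢c) λ r →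
      trans (reflexive (≡.cong (M (Fin.suc r)) (Finₚ.punchIn-punchOut j≢c))) (Mc≈0 (Fin.suc r)))

  AgreeOutside : ∀ {n} → Fin n → Matrix n → Matrix n → Set
  AgreeOutside i M N = ∀ r → r ≢ i → ∀ s → M r s ≈ N r s

  det-linear : ∀ {n} (i : Fin n) {M M₁ M₂ : Matrix n} α β →
    AgreeOutside i M₁ M → AgreeOutside i M₂ M → (∀ s → M i s ≈ α * M₁ i s + β * M₂ i s) →
    det M ≈ α * det M₁ + β * det M₂
  det-linear {suc n} i {M} {M₁} {M₂} α β M₁≈M M₂≈M Mᵢ≈ =
    trans (∑Fin-cong (suc n) {laplaceTerm M} (term i M₁≈M M₂≈M Mᵢ≈))
          (∑Fin-linear (suc n) α β (laplaceTerm M₁) (laplaceTerm M₂))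
    where
    term : ∀ i → AgreeOutside i M₁ M → AgreeOutside i M₂ M → (∀ s → M i s ≈ α * M₁ i s + β * M₂ i s) →
      ∀ j → sgn j * (M Fin.zero j * det (minor M j))
          ≈ α * (sgn j * (M₁ Fin.zero j * det (minor M₁ j))) + β * (sgn j * (M₂ Fin.zero j * det (minor M₂ j)))
    term Fin.zero M₁≈M M₂≈M M₀≈ j = begin
      sgn j * (M Fin.zero j * det (minor M j))
        ≈⟨ *-congˡ (*-congʳ (M₀≈ j)) ⟩
      sgn j * ((α * M₁ Fin.zero j + β * M₂ Fin.zero j) * det (minor M j))
        ≈⟨ *-congˡ (trans (distribʳ _ _ _) (+-cong (*-assoc α _ _) (*-assoc β _ _))) ⟩
      sgn j * (α * (M₁ Fin.zero j * det (minor M j)) + β * (M₂ Fin.zero j * det (minor M j)))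
        ≈⟨ *-linear (sgn j) α β _ _ ⟩
      α * (sgn j * (M₁ Fin.zero j * det (minor M j))) + β * (sgn j * (M₂ Fin.zero j * det (minor M j)))
        ≈⟨ +-cong (*-congˡ (*-congˡ (*-congˡ (det-cong (λ r s → sym (M₁≈M (Fin.suc r) (λ ()) _))))))
                  (*-congˡ (*-congˡ (*-congˡ (det-cong (λ r s → sym (M₂≈M (Fin.suc r) (λ ()) _)))))) ⟩
      α * (sgn j * (M₁ Fin.zero j * det (minor M₁ j))) + β * (sgn j * (M₂ Fin.zero j * det (minor M₂ j))) ∎
    term (Fin.suc i) M₁≈M M₂≈M Mᵢ≈ j = begin
      sgn j * (M Fin.zero j * det (minor M j))
        ≈⟨ *-congˡ (*-congˡ (det-linear i α β
              (λ r r≢i s → M₁≈M (Fin.suc r) (r≢i ∘ Finₚ.suc-injective) _)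
              (λ r r≢i s → M₂≈M (Fin.suc r) (r≢i ∘ Finₚ.suc-injective) _)
              (λ s → Mᵢ≈ _))) ⟩
      sgn j * (M Fin.zero j * (α * det (minor M₁ j) + β * det (minor M₂ j)))
        ≈⟨ *-congˡ (trans (distribˡ _ _ _) (+-cong (*-leftComm _ α _) (*-leftComm _ β _))) ⟩
      sgn j * (α * (M Fin.zero j * det (minor M₁ j)) + β * (M Fin.zero j * det (minor M₂ j)))
        ≈⟨ *-linear (sgn j) α β _ _ ⟩
      α * (sgn j * (M Fin.zero j * det (minor M₁ j))) + β * (sgn j * (M Fin.zero j * det (minor M₂ j)))
        ≈⟨ +-cong (*-congˡ (*-congˡ (*-congʳ (sym (M₁≈M Fin.zero (λ ()) j)))))
                  (*-congˡ (*-congˡ (*-congʳ (sym (M₂≈M Fin.zero (λ ()) j))))) ⟩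
      α * (sgn j * (M₁ Fin.zero j * det (minor M₁ j))) + β * (sgn j * (M₂ Fin.zero j * det (minor M₂ j))) ∎

  det-additive : ∀ {n} (i : Fin n) {M M₁ M₂ : Matrix n} →
    AgreeOutside i M₁ M → AgreeOutside i M₂ M → (∀ s → M i s ≈ M₁ i s + M₂ i s) →
    det M ≈ det M₁ + det M₂
  det-additive i M₁≈M M₂≈M Mᵢ≈ =
    trans (det-linear i 1# 1# M₁≈M M₂≈M λ s → trans (Mᵢ≈ s) (sym (+-cong (*-identityˡ _) (*-identityˡ _))))
          (+-cong (*-identityˡ _) (*-identityˡ _))

  -- The expansion of a determinant along two rows v, w: ∑ⱼ ∑ₗ ±vⱼ w_{j↑l} K j l.
  pairExpansion : ∀ n → (v w : Fin (suc n) → Carrier) → (Fin (suc n) → Fin n → Carrier) → Carrier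
  pairExpansion n v w K =
    ∑Fin (suc n) (λ j → sgn j * (v j * ∑Fin n (λ l → sgn l * (w (punchIn j l) * K j l))))

  -- K j l depends only on the unordered pair of columns {j, j↑l}.
  PairSymmetric : ∀ n → (Fin (suc n) → Fin n → Carrier) → Set
  PairSymmetric zero    K = ⊤
  PairSymmetric (suc n) K =
    (∀ l → K Fin.zero l ≈ K (Fin.suc l) Fin.zero) × PairSymmetric n (λ j l → K (Fin.suc j) (Fin.suc l))

  PairSymmetric-cong : ∀ n {K K′ : Fin (suc n) → Fin n → Carrier} →
    (∀ j l → K j l ≈ K′ j l) → PairSymmetric n K → PairSymmetric n K′
  PairSymmetric-cong zero    K≈K′ _ = tt
  PairSymmetric-cong (suc n) K≈K′ (sym₀ , symₛ) =
    (λ l → trans (sym (K≈K′ _ _)) (trans (sym₀ l) (K≈K′ _ _))) , PairSymmetric-cong n (λ j l → K≈K′ _ _) symₛ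

  doubleMinors-pairSymmetric : ∀ p (G : (Fin p → Fin (suc (suc p))) → Carrier) →
    (∀ f g → (∀ u → f u ≡ g u) → G f ≈ G g) →
    PairSymmetric (suc p) (λ j l → G (punchIn j ∘ punchIn l))
  doubleMinors-pairSymmetric zero    G G-cong = (λ l → refl) , tt
  doubleMinors-pairSymmetric (suc p) G G-cong = (λ l → refl) ,
    PairSymmetric-cong (suc p) {λ j l → G (Fin.lift 1 (punchIn j ∘ punchIn l))}
      (λ j l → G-cong _ (punchIn (Fin.suc j) ∘ punchIn (Fin.suc l)) λ { Fin.zero → ≡.refl ; (Fin.suc u) → ≡.refl })
      (doubleMinors-pairSymmetric p (G ∘ Fin.lift 1)
        (λ f g f≗g → G-cong _ _ λ { Fin.zero → ≡.refl ; (Fin.suc u) → ≡.cong Fin.suc (f≗g u) }))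

  pairExpansion-equalRows : ∀ n v w K → PairSymmetric n K → (∀ s → w s ≈ v s) → pairExpansion n v w K ≈ 0#
  pairExpansion-equalRows zero    v w K _ _ =
    trans (+-identityʳ _) (y≈0⇒s*[x*y]≈0 1# (v Fin.zero) refl)
  pairExpansion-equalRows (suc n) v w K (sym₀ , symₛ) w≈v = begin
    pairExpansion (suc n) v w K
      ≈⟨ +-cong first (trans (∑Fin-cong (suc n) {g = λ j → - (v₀ * a j) + sgn j * (v (Fin.suc j) * Z j)} rest)
                             (∑Fin-distrib-+ (suc n) (λ j → - (v₀ * a j)) (λ j → sgn j * (v (Fin.suc j) * Z j)))) ⟩
    v₀ * Y + (∑Fin (suc n) (λ j → - (v₀ * a j)) + pairExpansion n (v ∘ Fin.suc) (w ∘ Fin.suc) K′)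
      ≈⟨ +-congˡ (+-cong (trans (sym (-‿distrib-∑Fin (suc n) (λ j → v₀ * a j))) (-‿cong (sym (*-distribˡ-∑Fin (suc n) v₀ a))))
                         (pairExpansion-equalRows n (v ∘ Fin.suc) (w ∘ Fin.suc) K′ symₛ (w≈v ∘ Fin.suc))) ⟩
    v₀ * Y + (- (v₀ * Y) + 0#)
      ≈⟨ trans (+-congˡ (+-identityʳ _)) (-‿inverseʳ _) ⟩
    0# ∎
    where
    v₀ = v Fin.zero
    a : Fin (suc n) → Carrier
    a l = sgn l * (v (Fin.suc l) * K Fin.zero l)
    Y = ∑Fin (suc n) a
    K′ : Fin (suc n) → Fin n → Carrier
    K′ j l = K (Fin.suc j) (Fin.suc l)
    Z : Fin (suc n) → Carrier
    Z j = ∑Fin n (λ l → sgn l * (w (Fin.suc (punchIn j l)) * K′ j l))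
    first : 1# * (v₀ * ∑Fin (suc n) (λ l → sgn l * (w (Fin.suc l) * K Fin.zero l))) ≈ v₀ * Y
    first = trans (*-identityˡ _) (*-congˡ (∑Fin-cong (suc n) {g = a} λ l → *-congˡ (*-congʳ (w≈v _))))
    flipSign : ∀ s v x z → ((- 1#) * s) * (v * (1# * x + - z)) ≈ - (s * (v * x)) + s * (v * z)
    flipSign s v x z = begin
      ((- 1#) * s) * (v * (1# * x + - z))        ≈⟨ trans (*-assoc _ s _) (-1*x≈-x _) ⟩
      - (s * (v * (1# * x + - z)))               ≈⟨ -‿cong (*-congˡ (trans (distribˡ v _ _) (+-congʳ (*-congˡ (*-identityˡ x))))) ⟩
      - (s * (v * x + v * - z))                  ≈⟨ -‿cong (distribˡ s _ _) ⟩
      - (s * (v * x) + s * (v * - z))            ≈⟨ -‿+-comm _ _ ⟨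
      - (s * (v * x)) + - (s * (v * - z))        ≈⟨ +-congˡ (-‿cong (*-congˡ (-‿distribʳ-* v z))) ⟨
      - (s * (v * x)) + - (s * - (v * z))        ≈⟨ +-congˡ (-‿cong (-‿distribʳ-* s _)) ⟨
      - (s * (v * x)) + - - (s * (v * z))        ≈⟨ +-congˡ (-‿involutive _) ⟩
      - (s * (v * x)) + s * (v * z)              ∎
    rest : ∀ j → sgn (Fin.suc j) * (v (Fin.suc j) * ∑Fin (suc n) (λ l → sgn l * (w (punchIn (Fin.suc j) l) * K (Fin.suc j) l)))
               ≈ - (v₀ * a j) + sgn j * (v (Fin.suc j) * Z j)
    rest j = begin
      ((- 1#) * sgn j) * (v (Fin.suc j) * (1# * (w Fin.zero * K (Fin.suc j) Fin.zero) + _))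
        ≈⟨ *-congˡ (*-congˡ (+-congˡ (trans (∑Fin-cong n (λ l → sgn-suc l _)) (sym (-‿distrib-∑Fin n _))))) ⟩
      ((- 1#) * sgn j) * (v (Fin.suc j) * (1# * (w Fin.zero * K (Fin.suc j) Fin.zero) + - Z j))
        ≈⟨ flipSign (sgn j) _ _ (Z j) ⟩
      - (sgn j * (v (Fin.suc j) * (w Fin.zero * K (Fin.suc j) Fin.zero))) + sgn j * (v (Fin.suc j) * Z j)
        ≈⟨ +-congʳ (-‿cong (trans (*-congˡ (*-congˡ (*-cong (w≈v Fin.zero) (sym (sym₀ j)))))
                                  (trans (*-congˡ (*-leftComm _ v₀ _)) (*-leftComm (sgn j) v₀ _)))) ⟩
      - (v₀ * a j) + sgn j * (v (Fin.suc j) * Z j) ∎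

  det-equalRows₀₁ : ∀ m (M : Matrix (suc (suc m))) → (∀ s → M (Fin.suc Fin.zero) s ≈ M Fin.zero s) → det M ≈ 0#
  det-equalRows₀₁ m M M₁≈M₀ = pairExpansion-equalRows (suc m) (M Fin.zero) (M (Fin.suc Fin.zero))
    (λ j l → det (λ r u → M (Fin.suc (Fin.suc r)) (punchIn j (punchIn l u))))
    (doubleMinors-pairSymmetric m (λ f → det (λ r u → M (Fin.suc (Fin.suc r)) (f u)))
      (λ f g f≗g → det-cong (λ r u → reflexive (≡.cong (M (Fin.suc (Fin.suc r))) (f≗g u)))))
    M₁≈M₀

  updRow : ∀ {n} → Matrix n → Fin n → (Fin n → Carrier) → Matrix n
  updRow M i u r = if ⌊ r Fin.≟ i ⌋ then u else M r

  updRow-updated : ∀ {n} (M : Matrix n) i u s → updRow M i u i s ≈ u s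
  updRow-updated M i u s with i Fin.≟ i
  ... | yes _   = refl
  ... | no  i≢i = ⊥-elim (i≢i ≡.refl)

  updRow-other : ∀ {n} (M : Matrix n) {i} r u → r ≢ i → ∀ s → updRow M i u r s ≈ M r s
  updRow-other M {i} r u r≢i s with r Fin.≟ i
  ... | yes r≡i = ⊥-elim (r≢i r≡i)
  ... | no  _   = refl

  updRow-self : ∀ {n} (M : Matrix n) i → updRow M i (M i) ≈M M
  updRow-self M i r s with r Fin.≟ i
  ... | yes ≡.refl = refl
  ... | no  _      = refl

  updRow-agreeOutside : ∀ {n} (M : Matrix n) i u u′ → AgreeOutside i (updRow M i u) (updRow M i u′)
  updRow-agreeOutside M i u u′ r r≢i s = trans (updRow-other M r u r≢i s) (sym (updRow-other M r u′ r≢i s))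

  updRow-agreeOutside-cong : ∀ {n} {M N : Matrix n} {i} j y →
    AgreeOutside i M N → AgreeOutside i (updRow M j y) (updRow N j y)
  updRow-agreeOutside-cong j y M≈N r r≢i s with r Fin.≟ j
  ... | yes _ = refl
  ... | no  _ = M≈N r r≢i s

  Alternating : ℕ → Set
  Alternating n = ∀ (M : Matrix n) a b → a ≢ b → (∀ s → M a s ≈ M b s) → det M ≈ 0#

  det-equalRows-suc : ∀ n → Alternating n → ∀ (M : Matrix (suc n)) a b → a ≢ b →
    (∀ s → M (Fin.suc a) s ≈ M (Fin.suc b) s) → det M ≈ 0#
  det-equalRows-suc n alternating M a b a≢b Mₐ≈M_b = ∑Fin-zero (suc n) {laplaceTerm M} λ j →
    y≈0⇒s*[x*y]≈0 (sgn j) _ (alternating (minor M j) a b a≢b (Mₐ≈M_b ∘ punchIn j))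

  -- Replace rows 1 and j by x and y: D is bilinear, vanishes on x = y, and on x = M j
  -- (then rows 0 and 1 agree), so 0 = D(M₁ + Mⱼ, M₁ + Mⱼ) = D(M₁, Mⱼ) = det M.
  det-equalRows₀ : ∀ n → Alternating n → ∀ (M : Matrix (suc n)) b →
    (∀ s → M Fin.zero s ≈ M (Fin.suc b) s) → det M ≈ 0#
  det-equalRows₀ (suc m) alternating M Fin.zero    M₀≈M₁ = det-equalRows₀₁ m M (sym ∘ M₀≈M₁)
  det-equalRows₀ (suc m) alternating M (Fin.suc b) M₀≈Mⱼ = sym (begin
    0#                                              ≈⟨ D-diagonal (M i ⊕ M j) ⟨
    D (M i ⊕ M j) (M i ⊕ M j)                       ≈⟨ D-additiveˡ (M i) (M j) _ ⟩
    D (M i) (M i ⊕ M j) + D (M j) (M i ⊕ M j)       ≈⟨ +-cong (D-additiveʳ (M i) (M i) (M j)) (D-additiveʳ (M j) (M i) (M j)) ⟩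
    (D (M i) (M i) + D (M i) (M j)) + (D (M j) (M i) + D (M j) (M j))
      ≈⟨ +-cong (+-cong (D-diagonal (M i)) D-original) (+-cong D-swapped (D-diagonal (M j))) ⟩
    (0# + det M) + (0# + 0#)                        ≈⟨ trans (+-congˡ (+-identityˡ 0#)) (trans (+-identityʳ _) (+-identityˡ _)) ⟩
    det M                                           ∎)
    where
    Row = Fin (suc (suc m)) → Carrier
    i j : Fin (suc (suc m))
    i = Fin.suc Fin.zero
    j = Fin.suc (Fin.suc b)
    _⊕_ : Row → Row → Row
    (x ⊕ y) s = x s + y s
    upd₂ : Row → Row → Matrix (suc (suc m))
    upd₂ x y = updRow (updRow M i x) j y
    D : Row → Row → Carrier
    D x y = det (upd₂ x y)
    rowⱼ : ∀ x y s → upd₂ x y j s ≈ y s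
    rowⱼ x y s = updRow-updated (updRow M i x) j y s
    D-diagonal : ∀ x → D x x ≈ 0#
    D-diagonal x = det-equalRows-suc (suc m) alternating (upd₂ x x) Fin.zero (Fin.suc b) (λ ())
      λ s → sym (rowⱼ x x s)
    D-additiveˡ : ∀ x₁ x₂ y → D (x₁ ⊕ x₂) y ≈ D x₁ y + D x₂ y
    D-additiveˡ x₁ x₂ y = det-additive i
      (updRow-agreeOutside-cong j y (updRow-agreeOutside M i x₁ (x₁ ⊕ x₂)))
      (updRow-agreeOutside-cong j y (updRow-agreeOutside M i x₂ (x₁ ⊕ x₂)))
      λ s → refl
    D-additiveʳ : ∀ x y₁ y₂ → D x (y₁ ⊕ y₂) ≈ D x y₁ + D x y₂
    D-additiveʳ x y₁ y₂ = det-additive j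
      (updRow-agreeOutside (updRow M i x) j y₁ (y₁ ⊕ y₂)) (updRow-agreeOutside (updRow M i x) j y₂ (y₁ ⊕ y₂))
      λ s → trans (rowⱼ x (y₁ ⊕ y₂) s) (sym (+-cong (rowⱼ x y₁ s) (rowⱼ x y₂ s)))
    D-original : D (M i) (M j) ≈ det M
    D-original = det-cong (≈M.trans upd₂-original (updRow-self M j))
      where
      upd₂-original : upd₂ (M i) (M j) ≈M updRow M j (M j)
      upd₂-original r s with r Fin.≟ j
      ... | yes _ = refl
      ... | no  _ = updRow-self M i r s
    D-swapped : D (M j) (M i) ≈ 0#
    D-swapped = det-equalRows₀₁ m (upd₂ (M j) (M i))
      λ s → sym (M₀≈Mⱼ s)

  det-alternating : ∀ n → Alternating n
  det-alternating zero    M ()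
  det-alternating (suc n) M Fin.zero    Fin.zero    0≢0 _ = ⊥-elim (0≢0 ≡.refl)
  det-alternating (suc n) M Fin.zero    (Fin.suc b) _   M₀≈M_b =
    det-equalRows₀ n (det-alternating n) M b M₀≈M_b
  det-alternating (suc n) M (Fin.suc a) Fin.zero    _   Mₐ≈M₀ =
    det-equalRows₀ n (det-alternating n) M a (sym ∘ Mₐ≈M₀)
  det-alternating (suc n) M (Fin.suc a) (Fin.suc b) a≢b Mₐ≈M_b =
    det-equalRows-suc n (det-alternating n) M a b (a≢b ∘ ≡.cong Fin.suc) Mₐ≈M_b

  record RowAddition {n} (M M′ : Matrix n) : Set where
    field
      target source  : Fin n
      coefficient    : Carrier
      target≢source  : target ≢ source
      unchanged      : AgreeOutside target M′ M
      added          : ∀ s → M′ target s ≈ M target s + coefficient * M source s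

  det-rowAddition : ∀ {n} {M M′ : Matrix n} → RowAddition M M′ → det M′ ≈ det M
  det-rowAddition {n} {M} {M′} M↝M′ = begin
    det M′                                         ≈⟨ det-linear i 1# α (λ r r≢i s → sym (unchanged r r≢i s)) copy≈M′ M′ᵢ≈ ⟩
    1# * det M + α * det (updRow M i (M j))        ≈⟨ +-cong (*-identityˡ _) (*-congˡ copy-vanishes) ⟩
    det M + α * 0#                                 ≈⟨ trans (+-congˡ (zeroʳ α)) (+-identityʳ _) ⟩
    det M                                          ∎
    where
    open RowAddition M↝M′ renaming (target to i; source to j; coefficient to α)
    copy≈M′ : AgreeOutside i (updRow M i (M j)) M′
    copy≈M′ r r≢i s = trans (updRow-other M r (M j) r≢i s) (sym (unchanged r r≢i s))
    M′ᵢ≈ : ∀ s → M′ i s ≈ 1# * M i s + α * updRow M i (M j) i s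
    M′ᵢ≈ s = trans (added s) (+-cong (sym (*-identityˡ _)) (*-congˡ (sym (updRow-updated M i (M j) s))))
    copy-vanishes : det (updRow M i (M j)) ≈ 0#
    copy-vanishes = det-alternating n (updRow M i (M j)) i j target≢source
      λ s → trans (updRow-updated M i (M j) s) (sym (updRow-other M j (M j) (target≢source ∘ ≡.sym) s))

  dot : ∀ {n} → (Fin n → Carrier) → (Fin n → Carrier) → Carrier
  dot {n} u w = ∑Fin n (λ s → u s * w s)

  TrivialKernel : ∀ {n} → Matrix n → Set
  TrivialKernel M = ∀ w → (∀ r → dot (M r) w ≈ 0#) → ∀ s → w s ≈ 0#

  trivialKernel-rowAddition : ∀ {n} {M M′ : Matrix n} → RowAddition M M′ → TrivialKernel M → TrivialKernel M′
  trivialKernel-rowAddition {n} {M} {M′} M↝M′ ker w M′w≈0 = ker w Mw≈0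
    where
    open RowAddition M↝M′ renaming (target to i; source to j; coefficient to α)
    dot-cong : ∀ {u v} → (∀ s → u s ≈ v s) → dot u w ≈ dot v w
    dot-cong u≈v = ∑Fin-cong n (λ s → *-congʳ (u≈v s))
    off : ∀ r → r ≢ i → dot (M r) w ≈ 0#
    off r r≢i = trans (sym (dot-cong (unchanged r r≢i))) (M′w≈0 r)
    Mw≈0 : ∀ r → dot (M r) w ≈ 0#
    Mw≈0 r with r Fin.≟ i
    ... | no  r≢i    = off r r≢i
    ... | yes ≡.refl = begin
      dot (M i) w                                      ≈⟨ +-identityʳ _ ⟨
      dot (M i) w + 0#                                 ≈⟨ +-congˡ (trans (*-congˡ (off j (target≢source ∘ ≡.sym))) (zeroʳ α)) ⟨
      dot (M i) w + α * dot (M j) w                    ≈⟨ +-congˡ (*-distribˡ-∑Fin n α _) ⟩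
      dot (M i) w + ∑Fin n (λ s → α * (M j s * w s))   ≈⟨ ∑Fin-distrib-+ n _ _ ⟨
      ∑Fin n (λ s → M i s * w s + α * (M j s * w s))    ≈⟨ ∑Fin-cong n (λ s → trans (distribʳ _ _ _) (+-congˡ (*-assoc α _ _))) ⟨
      dot (λ s → M i s + α * M j s) w                  ≈⟨ dot-cong added ⟨
      dot (M′ i) w                                     ≈⟨ M′w≈0 i ⟩
      0#                                               ∎

  det-singleLaplaceTerm : ∀ {m} (M : Matrix (suc m)) c → (∀ r → M (Fin.suc r) c ≈ 0#) → det M ≈ laplaceTerm M c
  det-singleLaplaceTerm {m} M c column≈0 = ∑Fin-single (suc m) c (laplaceTerm M) λ t t≢c →
    y≈0⇒s*[x*y]≈0 (sgn t) _ (det-zeroColumn (minor M t) (punchOut t≢c) λ r →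
      trans (reflexive (≡.cong (M (Fin.suc r)) (Finₚ.punchIn-punchOut t≢c))) (column≈0 r))

  det-replaceColE0 : ∀ {m} (M : Matrix (suc m)) σ → det (replaceColE0 M (toℕ σ)) ≈ sgn σ * det (minor M σ)
  det-replaceColE0 M σ =
    trans (det-singleLaplaceTerm (replaceColE0 M (toℕ σ)) σ (λ r → entry (Fin.suc r)))
          (*-congˡ (trans (*-congʳ (entry Fin.zero)) (trans (*-identityˡ _) (det-cong untouched))))
    where
    entry : ∀ r → replaceColE0 M (toℕ σ) r σ ≈ (if ⌊ r Fin.≟ Fin.zero ⌋ then 1# else 0#)
    entry r with toℕ σ ℕ.≟ toℕ σ
    ... | yes _  = refl
    ... | no σ≢σ = ⊥-elim (σ≢σ ≡.refl)
    untouched : minor (replaceColE0 M (toℕ σ)) σ ≈M minor M σ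
    untouched r s with toℕ (punchIn σ s) ℕ.≟ toℕ σ
    ... | yes eq = ⊥-elim (Finₚ.punchInᵢ≢i σ s (Finₚ.toℕ-injective eq))
    ... | no  _  = refl

  -- det (replaceColE0 M σ) is the signed cofactor of the entry (0, σ).
  cramer : ∀ {m} (M : Matrix (suc m)) ρ →
    ∑Fin (suc m) (λ σ → M ρ σ * det (replaceColE0 M (toℕ σ))) ≈ det (updRow M Fin.zero (M ρ))
  cramer {m} M ρ = ∑Fin-cong (suc m) {g = laplaceTerm (updRow M Fin.zero (M ρ))} λ σ →
    trans (*-congˡ (det-replaceColE0 M σ)) (*-leftComm _ _ _)

  cramer-row₀ : ∀ {m} (M : Matrix (suc m)) →
    ∑Fin (suc m) (λ σ → M Fin.zero σ * det (replaceColE0 M (toℕ σ))) ≈ det M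
  cramer-row₀ M = trans (cramer M Fin.zero) (det-cong (updRow-self M Fin.zero))

  cramer-rowSuc : ∀ {m} (M : Matrix (suc m)) ρ →
    ∑Fin (suc m) (λ σ → M (Fin.suc ρ) σ * det (replaceColE0 M (toℕ σ))) ≈ 0#
  cramer-rowSuc {m} M ρ = trans (cramer M (Fin.suc ρ))
    (det-alternating (suc m) (updRow M Fin.zero (M (Fin.suc ρ))) Fin.zero (Fin.suc ρ) (λ ()) λ s → refl)

  trivialKernel-cong : ∀ {n} {M N : Matrix n} → M ≈M N → TrivialKernel M → TrivialKernel N
  trivialKernel-cong {n} M≈N ker w Nw≈0 =
    ker w λ r → trans (∑Fin-cong n (λ s → *-congʳ (M≈N r s))) (Nw≈0 r)

  -- If column 0 vanishes below a nonzero pivot, a kernel vector u of the minor extends to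
  -- the kernel vector (−(∑ₛ E₀,ₛ₊₁ uₛ)/pivot, u) of E.
  trivialKernel-minor₀ : ∀ {m} (E : Matrix (suc m)) (pivot≉0 : ¬ (E Fin.zero Fin.zero ≈ 0#)) →
    (∀ r → E (Fin.suc r) Fin.zero ≈ 0#) → TrivialKernel E → TrivialKernel (minor E Fin.zero)
  trivialKernel-minor₀ {m} E pivot≉0 column≈0 ker u minor·u≈0 s = ker w Ew≈0 (Fin.suc s)
    where
    pivot = E Fin.zero Fin.zero
    rest = ∑Fin m (λ s → E Fin.zero (Fin.suc s) * u s)
    w : Fin (suc m) → Carrier
    w Fin.zero    = - (rest * inv pivot pivot≉0)
    w (Fin.suc s) = u s
    Ew≈0 : ∀ r → dot (E r) w ≈ 0#
    Ew≈0 Fin.zero = begin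
      pivot * - (rest * inv pivot pivot≉0) + rest   ≈⟨ +-congʳ (-‿distribʳ-* pivot _) ⟨
      - (pivot * (rest * inv pivot pivot≉0)) + rest ≈⟨ +-congʳ (-‿cong (trans (*-leftComm pivot rest _)
                                                          (trans (*-congˡ (inv-correct pivot pivot≉0)) (*-identityʳ rest)))) ⟩
      - rest + rest                                 ≈⟨ -‿inverseˡ rest ⟩
      0#                                            ∎
    Ew≈0 (Fin.suc r) =
      trans (+-cong (trans (*-congʳ (column≈0 r)) (zeroˡ _)) (minor·u≈0 r)) (+-identityˡ 0#)

  module ColumnElimination {m} (M : Matrix (suc m)) (pivot≉0 : ¬ (M Fin.zero Fin.zero ≈ 0#)) where

    pivot = M Fin.zero Fin.zero

    multiplier : Fin m → Carrier
    multiplier r = - (M (Fin.suc r) Fin.zero * inv pivot pivot≉0)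

    eliminated : Fin m → Fin (suc m) → Carrier
    eliminated r s = M (Fin.suc r) s + multiplier r * M Fin.zero s

    cleared : ℕ → Matrix (suc m)
    cleared k Fin.zero    = M Fin.zero
    cleared k (Fin.suc r) = if ⌊ toℕ r ℕ.<? k ⌋ then eliminated r else M (Fin.suc r)

    cleared-done : ∀ {k} r → toℕ r < k → ∀ s → cleared k (Fin.suc r) s ≈ eliminated r s
    cleared-done {k} r r<k s with toℕ r ℕ.<? k
    ... | yes _   = refl
    ... | no  r≮k = ⊥-elim (r≮k r<k)

    cleared-pending : ∀ {k} r → ¬ (toℕ r < k) → ∀ s → cleared k (Fin.suc r) s ≈ M (Fin.suc r) s
    cleared-pending {k} r r≮k s with toℕ r ℕ.<? k
    ... | yes r<k = ⊥-elim (r≮k r<k)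
    ... | no  _   = refl

    cleared-step : ∀ {k} (k<m : k < m) → RowAddition (cleared k) (cleared (suc k))
    cleared-step {k} k<m = record
      { target        = Fin.suc rₖ
      ; source        = Fin.zero
      ; coefficient   = multiplier rₖ
      ; target≢source = λ ()
      ; unchanged     = unchanged
      ; added         = λ s → trans (cleared-done rₖ (ℕ.s≤s (ℕₚ.≤-reflexive toℕrₖ≡k)) s)
                                  (+-congʳ (sym (cleared-pending rₖ (ℕₚ.<-irrefl toℕrₖ≡k) s)))
      }
      where
      rₖ = Fin.fromℕ< k<m
      toℕrₖ≡k : toℕ rₖ ≡ k
      toℕrₖ≡k = Finₚ.toℕ-fromℕ< k<m
      unchanged : AgreeOutside (Fin.suc rₖ) (cleared (suc k)) (cleared k)
      unchanged Fin.zero    _ s = refl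
      unchanged (Fin.suc r) r≢rₖ s = byCase (toℕ r ℕ.<? k)
        where
        byCase : Dec (toℕ r < k) → cleared (suc k) (Fin.suc r) s ≈ cleared k (Fin.suc r) s
        byCase (yes r<k) = trans (cleared-done r (ℕₚ.m≤n⇒m≤1+n r<k) s) (sym (cleared-done r r<k s))
        byCase (no  r≮k) = trans (cleared-pending r r≮1+k s) (sym (cleared-pending r r≮k s))
          where
          r≮1+k : ¬ (toℕ r < suc k)
          r≮1+k r<1+k = r≢rₖ (≡.cong Fin.suc (Finₚ.toℕ-injective
            (≡.trans (ℕₚ.≤-antisym (ℕₚ.≤-pred r<1+k) (ℕₚ.≮⇒≥ r≮k)) (≡.sym toℕrₖ≡k))))

    cleared-invariant : ∀ k → k ≤ m → det (cleared k) ≈ det M × (TrivialKernel M → TrivialKernel (cleared k))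
    cleared-invariant zero    _     = det-cong cleared₀≈M , trivialKernel-cong (≈M.sym cleared₀≈M)
      where
      cleared₀≈M : cleared 0 ≈M M
      cleared₀≈M Fin.zero    s = refl
      cleared₀≈M (Fin.suc r) s = cleared-pending {0} r (λ ()) s
    cleared-invariant (suc k) k<m =
      trans (det-rowAddition step) (proj₁ invariant) , trivialKernel-rowAddition step ∘ proj₂ invariant
      where
      step = cleared-step k<m
      invariant = cleared-invariant k (ℕₚ.<⇒≤ k<m)

    E : Matrix (suc m)
    E = cleared m

    E-column₀ : ∀ r → E (Fin.suc r) Fin.zero ≈ 0#
    E-column₀ r = trans (cleared-done r (Finₚ.toℕ<n r) Fin.zero) (begin
      M (Fin.suc r) Fin.zero + - (M (Fin.suc r) Fin.zero * inv pivot pivot≉0) * pivot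
        ≈⟨ +-congˡ (trans (sym (-‿distribˡ-* _ pivot)) (-‿cong (trans (*-assoc _ _ pivot)
             (trans (*-congˡ (inverseˡ pivot pivot≉0)) (*-identityʳ _))))) ⟩
      M (Fin.suc r) Fin.zero + - M (Fin.suc r) Fin.zero
        ≈⟨ -‿inverseʳ _ ⟩
      0# ∎)

    det-E : det E ≈ pivot * det (minor E Fin.zero)
    det-E = trans (det-singleLaplaceTerm E Fin.zero E-column₀) (*-identityˡ _)

  ¬¬-∀Fin : ∀ n {P : Fin n → Set} → (∀ r → ¬ ¬ P r) → ¬ ¬ (∀ r → P r)
  ¬¬-∀Fin zero    ¬¬P ¬∀P = ¬∀P (λ ())
  ¬¬-∀Fin (suc n) ¬¬P ¬∀P = ¬¬P Fin.zero λ P₀ →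
    ¬¬-∀Fin n (¬¬P ∘ Fin.suc) λ Pₛ → ¬∀P λ { Fin.zero → P₀ ; (Fin.suc r) → Pₛ r }

  -- Gaussian elimination: some entry of column 0 is nonzero (else e₀ is in the kernel);
  -- move it to the pivot position, clear the column and recurse on the minor.
  trivialKernel⇒det≉0 : ∀ n (M : Matrix n) → TrivialKernel M → ¬ (det M ≈ 0#)
  trivialKernel⇒det≉0 zero    M ker det≈0 = 0≉1 (sym det≈0)
  trivialKernel⇒det≉0 (suc m) M ker det≈0 = ¬¬-∀Fin (suc m) column₀-zero column₀-notZero
    where
    e₀ : Fin (suc m) → Carrier
    e₀ Fin.zero    = 1#
    e₀ (Fin.suc _) = 0#

    column₀-notZero : ¬ (∀ r → M r Fin.zero ≈ 0#)
    column₀-notZero column≈0 = 0≉1 (sym (ker e₀ Me₀≈0 Fin.zero))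
      where
      Me₀≈0 : ∀ r → dot (M r) e₀ ≈ 0#
      Me₀≈0 r = trans (+-cong (trans (*-congʳ (column≈0 r)) (zeroˡ 1#)) (∑Fin-zero m (λ s → zeroʳ _)))
                      (+-identityʳ 0#)

    withPivot : ∀ (N : Matrix (suc m)) → TrivialKernel N → det N ≈ 0# → ¬ (N Fin.zero Fin.zero ≈ 0#) → ⊥
    withPivot N kerN detN≈0 pivot≉0 = trivialKernel⇒det≉0 m (minor E Fin.zero)
      (trivialKernel-minor₀ E pivot≉0 E-column₀ (proj₂ invariant kerN))
      (*-cancelˡ-≉0 pivot≉0 (trans (sym det-E) (trans (proj₁ invariant) (trans detN≈0 (sym (zeroʳ pivot))))))
      where
      open ColumnElimination N pivot≉0
      invariant = cleared-invariant m ℕₚ.≤-refl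

    pivotFrom : ∀ r → ¬ (M r Fin.zero ≈ 0#) → M Fin.zero Fin.zero ≈ 0# → ⊥
    pivotFrom Fin.zero    Mr₀≉0 M₀₀≈0 = Mr₀≉0 M₀₀≈0
    pivotFrom (Fin.suc r) Mr₀≉0 M₀₀≈0 =
      withPivot M′ (trivialKernel-rowAddition step ker) (trans (det-rowAddition step) det≈0)
        λ M′₀₀≈0 → Mr₀≉0 (trans (sym (trans (+-congʳ M₀₀≈0) (trans (+-identityˡ _) (*-identityˡ _)))) M′₀₀≈0)
      where
      M′ = updRow M Fin.zero (λ s → M Fin.zero s + 1# * M (Fin.suc r) s)
      step : RowAddition M M′
      step = record
        { target        = Fin.zero
        ; source        = Fin.suc r
        ; coefficient   = 1#
        ; target≢source = λ ()
        ; unchanged     = λ r′ r′≢0 s → updRow-other M r′ _ r′≢0 s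
        ; added         = λ s → refl
        }

    column₀-zero : ∀ r → ¬ ¬ (M r Fin.zero ≈ 0#)
    column₀-zero r Mr₀≉0 = ¬¬-excluded-middle λ
      { (yes M₀₀≈0) → pivotFrom r Mr₀≉0 M₀₀≈0
      ; (no  M₀₀≉0) → withPivot M ker det≈0 M₀₀≉0
      }

  -- The binomial theorem for A + t·I

  binomialTerm : Carrier → ℕ → ℕ → Carrier
  binomialTerm t j i = ι (j C i) * (t ^F (j ∸ i))

  binomialTerm-above : ∀ t {j i} → j < i → binomialTerm t j i ≈ 0#
  binomialTerm-above t j<i = trans (*-congʳ (reflexive (≡.cong ι (ℕᶜ.k>n⇒nCk≡0 j<i)))) (zeroˡ _)

  binomialTerm-diagonal : ∀ t i → binomialTerm t i i ≈ 1#
  binomialTerm-diagonal t i = trans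
    (*-cong (trans (reflexive (≡.cong ι (ℕᶜ.nCn≡1 i))) (+-identityʳ 1#)) (reflexive (≡.cong (t ^F_) (ℕₚ.n∸n≡0 i))))
    (*-identityʳ 1#)

  binomialTerm-pascal : ∀ t j i → binomialTerm t (suc j) i ≈ atPred (binomialTerm t j) i + t * binomialTerm t j i
  binomialTerm-pascal t j zero    = trans (*-leftComm (ι 1) t _) (sym (+-identityˡ _))
  binomialTerm-pascal t j (suc i) = begin
    ι (suc j C suc i) * (t ^F (j ∸ i))
      ≈⟨ *-congʳ (trans (reflexive (≡.cong ι (≡.sym (ℕᶜ.nCk+nC[k+1]≡[n+1]C[k+1] j i)))) (ι-homo-+ (j C i) (j C suc i))) ⟩
    (ι (j C i) + ι (j C suc i)) * (t ^F (j ∸ i))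
      ≈⟨ distribʳ _ _ _ ⟩
    binomialTerm t j i + ι (j C suc i) * (t ^F (j ∸ i))
      ≈⟨ +-congˡ (nextTerm (i ℕ.<? j)) ⟩
    binomialTerm t j i + t * binomialTerm t j (suc i) ∎
    where
    nextTerm : Dec (i < j) → ι (j C suc i) * (t ^F (j ∸ i)) ≈ t * binomialTerm t j (suc i)
    nextTerm (yes i<j) = trans (*-congˡ (reflexive (≡.cong (t ^F_) (ℕₚ.+-∸-assoc 1 i<j)))) (*-leftComm _ t _)
    nextTerm (no  i≮j) = trans (*-congʳ (reflexive (≡.cong ι (ℕᶜ.k>n⇒nCk≡0 j<1+i)))) (trans (zeroˡ _)
                           (sym (trans (*-congˡ (binomialTerm-above t j<1+i)) (zeroʳ t))))
      where
      j<1+i : j < suc i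
      j<1+i = ℕ.s≤s (ℕₚ.≮⇒≥ i≮j)

  module _ {n : ℕ} (A : Matrix n) where

    *M-lincomb-powers : ∀ m (v : ℕ → Carrier) → v m ≈ 0# →
      (A *M lincomb m v (A ^M_)) ≈M lincomb m (atPred v) (A ^M_)
    *M-lincomb-powers m v v[m]≈0 = ≈M.trans (*M-lincomb m A v (A ^M_)) λ r s → begin
      lincomb m v (λ i → A ^M suc i) r s           ≈⟨ lincomb-entry m v _ r s ⟩
      ∑≤ m (λ i → v i * (A ^M suc i) r s)          ≈⟨ ∑≤-shiftDown m v (λ i → (A ^M i) r s) (trans (*-congʳ v[m]≈0) (zeroˡ _)) ⟩
      ∑≤ m (λ i → atPred v i * (A ^M i) r s)       ≈⟨ lincomb-entry m (atPred v) _ r s ⟨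
      lincomb m (atPred v) (A ^M_) r s             ∎

    binomial-theorem : ∀ m t j → j ≤ m → ((A +M (t ·M IM)) ^M j) ≈M lincomb m (binomialTerm t j) (A ^M_)
    binomial-theorem m t zero    _   r s = sym (begin
      lincomb m (binomialTerm t 0) (A ^M_) r s         ≈⟨ lincomb-entry m _ _ r s ⟩
      ∑≤ m (λ i → binomialTerm t 0 i * (A ^M i) r s)   ≈⟨ ∑≤-single m 0 _ ℕ.z≤n off ⟩
      binomialTerm t 0 0 * IM r s                       ≈⟨ trans (*-congʳ (binomialTerm-diagonal t 0)) (*-identityˡ _) ⟩
      IM r s                                            ∎)
      where
      off : ∀ i → i ≤ m → i ≢ 0 → binomialTerm t 0 i * (A ^M i) r s ≈ 0#
      off i _ i≢0 = trans (*-congʳ (binomialTerm-above t (ℕₚ.n≢0⇒n>0 i≢0))) (zeroˡ _)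
    binomial-theorem m t (suc j) j<m r s = begin
      ((A +M (t ·M IM)) *M ((A +M (t ·M IM)) ^M j)) r s
        ≈⟨ *M-cong {M = A +M (t ·M IM)} ≈M.refl (binomial-theorem m t j (ℕₚ.<⇒≤ j<m)) r s ⟩
      ((A +M (t ·M IM)) *M lincomb m (binomialTerm t j) (A ^M_)) r s
        ≈⟨ +·IM-*M A t (lincomb m (binomialTerm t j) (A ^M_)) r s ⟩
      ((A *M lincomb m (binomialTerm t j) (A ^M_)) +M (t ·M lincomb m (binomialTerm t j) (A ^M_))) r s
        ≈⟨ +-congʳ (*M-lincomb-powers m _ (binomialTerm-above t j<m) r s) ⟩
      (lincomb m (atPred (binomialTerm t j)) (A ^M_) +M (t ·M lincomb m (binomialTerm t j) (A ^M_))) r s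
        ≈⟨ lincomb-+M-·M m _ t _ _ r s ⟩
      lincomb m (λ i → atPred (binomialTerm t j) i + t * binomialTerm t j i) (A ^M_) r s
        ≈⟨ lincomb-cong m (λ i _ → sym (binomialTerm-pascal t j i)) (λ _ _ → ≈M.refl) r s ⟩
      lincomb m (binomialTerm t (suc j)) (A ^M_) r s ∎

  -- Distance matrices A₀, …, A_d obeying a three-term recurrence

  recurrence-coefficient : ∀ U u p α β γ κ → κ ≈ (γ + α) + β →
    ((U * β + u * α) + p * γ) + (- κ) * u ≈ ((U - u) * β) - ((u - p) * γ)
  recurrence-coefficient U u p α β γ κ κ≈γ+α+β = begin
    ((U * β + u * α) + p * γ) + (- κ) * u
      ≈⟨ +-congˡ (trans (sym (-‿distribˡ-* κ u)) (-‿cong (*-congʳ (trans κ≈γ+α+β (+-comm _ β))))) ⟩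
    ((U * β + u * α) + p * γ) + - ((β + (γ + α)) * u)
      ≈⟨ +-congˡ (-‿cong (trans (distribʳ u β _) (+-congˡ (distribʳ u γ α)))) ⟩
    ((U * β + u * α) + p * γ) + - (β * u + (γ * u + α * u))
      ≈⟨ +-congˡ (trans (sym (-‿+-comm _ _)) (+-congˡ (sym (-‿+-comm _ _)))) ⟩
    ((U * β + u * α) + p * γ) + (- (β * u) + (- (γ * u) + - (α * u)))
      ≈⟨ +-interchange _ _ _ _ ⟩
    ((U * β + u * α) + - (β * u)) + (p * γ + (- (γ * u) + - (α * u)))
      ≈⟨ +-cong (trans (+-assoc _ _ _) (trans (+-congˡ (+-comm _ _)) (sym (+-assoc _ _ _)))) (sym (+-assoc _ _ _)) ⟩
    ((U * β + - (β * u)) + u * α) + ((p * γ + - (γ * u)) + - (α * u))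
      ≈⟨ +-interchange _ _ _ _ ⟩
    ((U * β + - (β * u)) + (p * γ + - (γ * u))) + (u * α + - (α * u))
      ≈⟨ trans (+-congˡ (trans (+-congˡ (-‿cong (*-comm α u))) (-‿inverseʳ _))) (+-identityʳ _) ⟩
    (U * β + - (β * u)) + (p * γ + - (γ * u))
      ≈⟨ +-cong (+-congˡ (-‿cong (*-comm β u))) (+-congˡ (-‿cong (*-comm γ u))) ⟩
    (U * β - u * β) + (p * γ - u * γ)
      ≈⟨ +-cong ([y-z]x≈yx-zx β U u) (trans (-‿cong ([y-z]x≈yx-zx γ u p)) (⁻¹-anti-homo‿- _ _)) ⟨
    ((U - u) * β) - ((u - p) * γ) ∎

  module DistanceMatrices
    (d k n : ℕ) (c a b : ℕ → Carrier) (Ai : ℕ → Matrix n) (x : ℕ → ℕ → Carrier)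
    (c₁≈1 : c 1 ≈ 1#) (c[d+1]≈0 : c (suc d) ≈ 0#) (b[d]≈0 : b d ≈ 0#)
    (k≈c+a+b : ∀ i → i ≤ suc d → ι k ≈ ((c i + a i) + b i))
    (c-increasing : ∀ i → 1 ≤ i → i < d → c i ≤F c (suc i))
    (A₀≈I : Ai 0 ≈M IM)
    (minimal : ∀ (p : ℕ → Carrier) → ∑M≤ d (λ i → p i ·M (Ai 1 ^M i)) ≈M 0M → ∀ i → i ≤ d → p i ≈ 0#)
    (A*A₀ : (Ai 1 *M Ai 0) ≈M ((a 0 ·M Ai 0) +M (c 1 ·M Ai 1)))
    (A*Aᵢ₊₁ : ∀ i → suc i ≤ d → (Ai 1 *M Ai (suc i)) ≈M
       (((b i ·M Ai i) +M (a (suc i) ·M Ai (suc i))) +M (c (suc (suc i)) ·M Ai (suc (suc i)))))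
    (x-recurrence : ∀ i → i < d → ∀ j → j ≤ d →
       x (suc i) j ≈ (((x i (suc j) - x i j) * b j) - ((x i j - atPred (x i) j) * c j)))
    where

    A B X : Matrix n
    A = Ai 1
    B = A +M ((- ι k) ·M IM)
    X = lincomb d (x 0) Ai

    Q : Matrix (suc d)
    Q r s = x (toℕ s) (toℕ r)

    β : ℕ → ℕ → Carrier
    β = binomialTerm (- ι k)

    A*Aⱼ : ∀ j → j ≤ d → ∀ r s →
      (A *M Ai j) r s ≈ (atPred (λ i → b i * Ai i r s) j + a j * Ai j r s) + c (suc j) * Ai (suc j) r s
    A*Aⱼ zero    _   r s = trans (A*A₀ r s) (+-congʳ (sym (+-identityˡ _)))
    A*Aⱼ (suc i) i<d r s = A*Aᵢ₊₁ i i<d r s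

    A*lincomb : ∀ u → (A *M lincomb d u Ai) ≈M lincomb d (λ j → (u (suc j) * b j + u j * a j) + atPred u j * c j) Ai
    A*lincomb u r s = begin
      (A *M lincomb d u Ai) r s
        ≈⟨ *M-lincomb d A u Ai r s ⟩
      lincomb d u (λ j → A *M Ai j) r s
        ≈⟨ lincomb-entry d u _ r s ⟩
      ∑≤ d (λ j → u j * (A *M Ai j) r s)
        ≈⟨ ∑≤-cong d (λ j j≤d → *-congˡ (A*Aⱼ j j≤d r s)) ⟩
      ∑≤ d (λ j → u j * ((atPred (λ i → b i * Ai i r s) j + a j * Ai j r s) + c (suc j) * Ai (suc j) r s))
        ≈⟨ ∑≤-threeTerm d u a b c (λ j → Ai j r s) b[d]≈0 c[d+1]≈0 ⟩
      ∑≤ d (λ j → ((u (suc j) * b j + u j * a j) + atPred u j * c j) * Ai j r s)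
        ≈⟨ lincomb-entry d _ Ai r s ⟨
      lincomb d (λ j → (u (suc j) * b j + u j * a j) + atPred u j * c j) Ai r s ∎

    B*lincomb : ∀ u →
      (B *M lincomb d u Ai) ≈M lincomb d (λ j → ((u (suc j) - u j) * b j) - ((u j - atPred u j) * c j)) Ai
    B*lincomb u =
      ≈M.trans (+·IM-*M A (- ι k) (lincomb d u Ai)) (≈M.trans (+M-cong (A*lincomb u) ≈M.refl)
        (≈M.trans (lincomb-+M-·M d _ (- ι k) u Ai)
          (lincomb-cong d (λ j j≤d → recurrence-coefficient _ _ _ _ _ _ _ (k≈c+a+b j (ℕₚ.m≤n⇒m≤1+n j≤d)))
                          (λ _ _ → ≈M.refl))))

    B^i*X : ∀ i → i ≤ d → ((B ^M i) *M X) ≈M lincomb d (x i) Ai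
    B^i*X zero    _   = *M-identityˡ X
    B^i*X (suc i) i<d =
      ≈M.trans (*M-assoc B (B ^M i) X) (≈M.trans (*M-cong {M = B} ≈M.refl (B^i*X i (ℕₚ.<⇒≤ i<d)))
        (≈M.trans (B*lincomb (x i)) (lincomb-cong d (λ j j≤d → sym (x-recurrence i i<d j j≤d)) (λ _ _ → ≈M.refl))))

    -- c_{j+2} A_{j+2} = A A_{j+1} − b_j A_j − a_{j+1} A_{j+1} with c_{j+2} ≠ 0.
    A-commutes-pair : ∀ j → suc j ≤ d → Commute A (Ai j) × Commute A (Ai (suc j))
    A-commutes-pair zero    _     = commute-cong (≈M.sym A₀≈I) (commute-IM A) , ≈M.refl
    A-commutes-pair (suc j) 2+j≤d = A-Aⱼ₊₁ , commute-cancel c[j+2]≉0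
      (commute-cancel-+M (commute-+M (commute-·M (b j) A-Aⱼ) (commute-·M (a (suc j)) A-Aⱼ₊₁))
        (commute-cong (A*Aᵢ₊₁ j (ℕₚ.<⇒≤ 2+j≤d)) (commute-*M ≈M.refl A-Aⱼ₊₁)))
      where
      c[j+2]≉0 = 1≤x⇒x≉0 (1≤-of-increasing d c (≤F-reflexive (sym c₁≈1)) c-increasing (suc (suc j)) (ℕ.s≤s ℕ.z≤n) 2+j≤d)
      A-Aⱼ = proj₁ (A-commutes-pair j (ℕₚ.<⇒≤ 2+j≤d))
      A-Aⱼ₊₁ = proj₂ (A-commutes-pair j (ℕₚ.<⇒≤ 2+j≤d))

    A-commutes-Aⱼ : ∀ j → j ≤ d → Commute A (Ai j)
    A-commutes-Aⱼ zero    _   = commute-cong (≈M.sym A₀≈I) (commute-IM A)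
    A-commutes-Aⱼ (suc j) j<d = proj₂ (A-commutes-pair j j<d)

    X-commutes-A^i : ∀ i → Commute X (A ^M i)
    X-commutes-A^i = commute-^M (commute-sym (commute-lincomb d (x 0) Ai A-commutes-Aⱼ))

    B-powers : ∀ v → lincomb d v (B ^M_) ≈M lincomb d (λ i → ∑≤ d (λ j → v j * β j i)) (A ^M_)
    B-powers v = ≈M.trans (lincomb-cong d (λ _ _ → refl) (binomial-theorem A d (- ι k)))
                          (lincomb-lincomb d d v β (A ^M_))

    B-powers*X : ∀ v → (lincomb d v (B ^M_) *M X) ≈M lincomb d (λ r → ∑≤ d (λ j → v j * x j r)) Ai
    B-powers*X v = ≈M.trans (lincomb-*M d v (B ^M_) X)
      (≈M.trans (lincomb-cong d (λ _ _ → refl) B^i*X) (lincomb-lincomb d d v x Ai))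

    Q-row-dot : ∀ (v : ℕ → Carrier) ρ → ∑≤ d (λ j → v j * x j (toℕ ρ)) ≈ ∑Fin (suc d) (λ σ → Q ρ σ * v (toℕ σ))
    Q-row-dot v ρ = trans (∑≤-cong d (λ j _ → *-comm _ _)) (∑≤≈∑Fin d (λ j → x j (toℕ ρ) * v j))

    lincomb-e₀ : ∀ (v : ℕ → Carrier) → v 0 ≈ 1# → (∀ r → r < d → v (suc r) ≈ 0#) → lincomb d v Ai ≈M IM
    lincomb-e₀ v v₀≈1 vₛ≈0 r s = begin
      lincomb d v Ai r s              ≈⟨ lincomb-entry d v Ai r s ⟩
      ∑≤ d (λ i → v i * Ai i r s)     ≈⟨ ∑≤-single d 0 _ ℕ.z≤n off ⟩
      v 0 * Ai 0 r s                  ≈⟨ *-cong v₀≈1 (A₀≈I r s) ⟩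
      1# * IM r s                     ≈⟨ *-identityˡ _ ⟩
      IM r s                          ∎
      where
      off : ∀ i → i ≤ d → i ≢ 0 → v i * Ai i r s ≈ 0#
      off zero    _   0≢0 = ⊥-elim (0≢0 ≡.refl)
      off (suc i) i<d _   = trans (*-congʳ (vₛ≈0 i i<d)) (zeroˡ _)

    module Inverse (detQ≉0 : ¬ (det Q ≈ 0#)) where

      z : ℕ → Carrier
      z j = det (replaceColE0 Q j) * inv (det Q) detQ≉0

      y : ℕ → Carrier
      y i = ∑FromTo i d (λ j →
              ((- 1#) ^F (j ∸ i)) * (ι (j C i) * ((ι k ^F (j ∸ i))
                * (det (replaceColE0 Q j) * inv (det Q) detQ≉0))))

      Xinv : Matrix n
      Xinv = lincomb d y (A ^M_)

      y≈z·β : ∀ i → y i ≈ ∑≤ d (λ j → z j * β j i)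
      y≈z·β i = ∑≤-cong d (λ j _ → term j)
        where
        term : ∀ j → (if ⌊ i ℕ.≤? j ⌋ then ((- 1#) ^F (j ∸ i)) * (ι (j C i) * ((ι k ^F (j ∸ i)) * z j)) else 0#)
                     ≈ z j * β j i
        term j with i ℕ.≤? j
        ... | no  i≰j = sym (trans (*-congˡ (binomialTerm-above (- ι k) (ℕₚ.≰⇒> i≰j))) (zeroʳ _))
        ... | yes _   = begin
          ((- 1#) ^F (j ∸ i)) * (ι (j C i) * ((ι k ^F (j ∸ i)) * z j))   ≈⟨ *-leftComm _ _ _ ⟩
          ι (j C i) * (((- 1#) ^F (j ∸ i)) * ((ι k ^F (j ∸ i)) * z j))   ≈⟨ *-congˡ (sym (*-assoc _ _ _)) ⟩
          ι (j C i) * ((((- 1#) ^F (j ∸ i)) * (ι k ^F (j ∸ i))) * z j)   ≈⟨ *-congˡ (*-congʳ ([-x]^n≈[-1]^n*x^n (ι k) (j ∸ i))) ⟨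
          ι (j C i) * (((- ι k) ^F (j ∸ i)) * z j)                        ≈⟨ trans (*-congˡ (*-comm _ _)) (*-leftComm _ _ _) ⟩
          z j * β j i                                                    ∎

      Qz-row : ∀ ρ → ∑≤ d (λ j → z j * x j (toℕ ρ)) ≈ ∑Fin (suc d) (λ σ → Q ρ σ * det (replaceColE0 Q (toℕ σ))) * inv (det Q) detQ≉0
      Qz-row ρ = trans (Q-row-dot z ρ) (trans (∑Fin-cong (suc d) (λ σ → sym (*-assoc (Q ρ σ) (det (replaceColE0 Q (toℕ σ))) (inv (det Q) detQ≉0))))
                                                  (sym (*-distribʳ-∑Fin (suc d) (inv (det Q) detQ≉0) cofactors)))
        where
        cofactors : Fin (suc d) → Carrier
        cofactors σ = Q ρ σ * det (replaceColE0 Q (toℕ σ))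

      Xinv*X : (Xinv *M X) ≈M IM
      Xinv*X = ≈M.trans (*M-cong (≈M.trans (lincomb-cong d (λ i _ → y≈z·β i) (λ _ _ → ≈M.refl)) (≈M.sym (B-powers z))) ≈M.refl)
        (≈M.trans (B-powers*X z) (lincomb-e₀ _ Qz₀≈1 Qzₛ≈0))
        where
        Qz₀≈1 : ∑≤ d (λ j → z j * x j 0) ≈ 1#
        Qz₀≈1 = trans (Qz-row Fin.zero) (trans (*-congʳ (cramer-row₀ Q)) (inv-correct (det Q) detQ≉0))
        Qzₛ≈0 : ∀ r → r < d → ∑≤ d (λ j → z j * x j (suc r)) ≈ 0#
        Qzₛ≈0 r r<d = trans (∑≤-cong d (λ j _ → *-congˡ (reflexive (≡.cong (λ t → x j (suc t)) (≡.sym (Finₚ.toℕ-fromℕ< r<d))))))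
                            (trans (Qz-row (Fin.suc (Fin.fromℕ< r<d))) (trans (*-congʳ (cramer-rowSuc Q _)) (zeroˡ _)))

      X*Xinv : (X *M Xinv) ≈M IM
      X*Xinv = ≈M.trans (*M-lincomb d X y (A ^M_))
        (≈M.trans (lincomb-cong d (λ _ _ → refl) (λ i _ → X-commutes-A^i i)) (≈M.trans (≈M.sym (lincomb-*M d y (A ^M_) X)) Xinv*X))

    extend : (Fin (suc d) → Carrier) → ℕ → Carrier
    extend w j with j ℕ.<? suc d
    ... | yes j<1+d = w (Fin.fromℕ< j<1+d)
    ... | no  _     = 0#

    extend-toℕ : ∀ w σ → extend w (toℕ σ) ≈ w σ
    extend-toℕ w σ with toℕ σ ℕ.<? suc d
    ... | yes σ<1+d = reflexive (≡.cong w (Finₚ.fromℕ<-toℕ σ σ<1+d))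
    ... | no  σ≮1+d = ⊥-elim (σ≮1+d (Finₚ.toℕ<n σ))

    invertible⇒trivialKernel : Invertible X → TrivialKernel Q
    invertible⇒trivialKernel (Y , X*Y≈I , _) w Qw≈0 σ =
      trans (sym (extend-toℕ w σ))
        (unitriangular-injective d w′ β (binomialTerm-above (- ι k)) (binomialTerm-diagonal (- ι k))
          (minimal _ (≈M.trans (≈M.sym (B-powers w′)) W≈0)) (toℕ σ) (ℕₚ.≤-pred (Finₚ.toℕ<n σ)))
      where
      w′ = extend w
      W = lincomb d w′ (B ^M_)
      Qw′≈0 : ∀ ρ → ∑≤ d (λ j → w′ j * x j (toℕ ρ)) ≈ 0#
      Qw′≈0 ρ = trans (Q-row-dot w′ ρ) (trans (∑Fin-cong (suc d) {g = λ σ → Q ρ σ * w σ} (λ σ → *-congˡ (extend-toℕ w σ))) (Qw≈0 ρ))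
      W*X≈0 : (W *M X) ≈M 0M
      W*X≈0 r s = trans (B-powers*X w′ r s) (trans (lincomb-entry d _ Ai r s) (∑≤-zero d λ i i≤d →
        trans (*-congʳ (trans (∑≤-cong d (λ j _ → *-congˡ (reflexive (≡.cong (x j) (≡.sym (Finₚ.toℕ-fromℕ< (ℕ.s≤s i≤d)))))))
                              (Qw′≈0 (Fin.fromℕ< (ℕ.s≤s i≤d)))))
              (zeroˡ _)))
      W≈0 : W ≈M 0M
      W≈0 = ≈M.trans (≈M.sym (*M-identityʳ W)) (≈M.trans (*M-cong ≈M.refl (≈M.sym X*Y≈I))
        (≈M.trans (≈M.sym (*M-assoc W X Y)) (≈M.trans (*M-cong W*X≈0 ≈M.refl) (*M-zeroˡ Y))))

    invertible⇒det≉0 : Invertible X → ¬ (det Q ≈ 0#)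
    invertible⇒det≉0 = trivialKernel⇒det≉0 (suc d) Q ∘ invertible⇒trivialKernel

theorem3 :
  (F : OrderedField) →
  let open OrderedField F
      open WithField F
  in
  (d k n : ℕ) → 2 ≤ d → 3 ≤ k →
  (c a b : ℕ → Carrier) →
  -- c i, a i, b i for 0 ≤ i ≤ d+1 (c, b at index -1 are 0)
  c 0 ≈ 0# → c 1 ≈ 1# → c (suc d) ≈ 0# →
  b 0 ≈ ι k → b d ≈ 0# → b (suc d) ≈ 0# → a 0 ≈ 0# →
  (∀ i → i ≤ suc d → ι k ≈ ((c i + a i) + b i)) →
  (∀ i → 1 ≤ i → i < d → c i ≤F c (suc i)) → c d ≤F ι k →
  (∀ i → suc i < d → b (suc i) ≤F b i) → 1# ≤F b (d ∸ 1) →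
  (Ai : ℕ → Matrix n) →
  -- A_0, ..., A_{d+1};  A = A_1
  Ai 0 ≈M IM → Ai (suc d) ≈M 0M →
  (∀ r → ∑Fin n (λ s → Ai 1 r s) ≈ ι k) →
  -- minimal polynomial of A has degree ≥ d+1:
  -- no nonzero polynomial of degree ≤ d annihilates A
  (∀ (p : ℕ → Carrier) → ∑M≤ d (λ i → p i ·M (Ai 1 ^M i)) ≈M 0M →
     ∀ i → i ≤ d → p i ≈ 0#) →
  ∑M≤ d Ai ≈M (λ _ _ → 1#) →
  (Ai 1 *M Ai 0) ≈M ((a 0 ·M Ai 0) +M (c 1 ·M Ai 1)) →
  (∀ i → suc i ≤ d →
     (Ai 1 *M Ai (suc i)) ≈M
       (((b i ·M Ai i) +M (a (suc i) ·M Ai (suc i)))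
          +M (c (suc (suc i)) ·M Ai (suc (suc i))))) →
  (x : ℕ → ℕ → Carrier) →
  -- x i j for 0 ≤ i ≤ d, 0 ≤ j ≤ d+1 (value at j = -1 is 0 via atPred)
  (∀ i → i ≤ d → x i (suc d) ≈ 0#) →
  (∀ i → i < d → ∀ j → j ≤ d →
     x (suc i) j ≈ (((x i (suc j) - x i j) * b j)
                      - ((x i j - atPred (x i) j) * c j))) →
  let X : Matrix n
      X = ∑M≤ d (λ j → x 0 j ·M Ai j)
      Q : Matrix (suc d)
      Q = λ r s → x (toℕ s) (toℕ r)
      y : ¬ (det Q ≈ 0#) → ℕ → Carrier
      y nz i = ∑FromTo i d (λ j →
                 ((- 1#) ^F (j ∸ i)) * (ι (j C i) * ((ι k ^F (j ∸ i))
                   * (det (replaceColE0 Q j) * inv (det Q) nz))))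
      Xinv : ¬ (det Q ≈ 0#) → Matrix n
      Xinv nz = ∑M≤ d (λ i → y nz i ·M (Ai 1 ^M i))
  in
  (Invertible X → ¬ (det Q ≈ 0#)) ×
  (¬ (det Q ≈ 0#) → Invertible X) ×
  ((nz : ¬ (det Q ≈ 0#)) →
     ((X *M Xinv nz) ≈M IM) × ((Xinv nz *M X) ≈M IM))
-- The hypotheses bound to _ are part of the setting but not needed for the conclusion.
theorem3 F d k n _ _ c a b _ c₁≈1 c[d+1]≈0 _ b[d]≈0 _ _ k≈c+a+b c-increasing _ _ _
         Ai A₀≈I _ _ minimal _ A*A₀ A*Aᵢ₊₁ x _ x-recurrence =
  invertible⇒det≉0 ,
  (λ detQ≉0 → Inverse.Xinv detQ≉0 , Inverse.X*Xinv detQ≉0 , Inverse.Xinv*X detQ≉0) ,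
  (λ detQ≉0 → Inverse.X*Xinv detQ≉0 , Inverse.Xinv*X detQ≉0)
  where
  open DistanceMatrices F d k n c a b Ai x c₁≈1 c[d+1]≈0 b[d]≈0 k≈c+a+b c-increasing
                        A₀≈I minimal A*A₀ A*Aᵢ₊₁ x-recurrence
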